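{- For every $n\ge1$, $$I_n(q,t)=t\,I_{n-1}(q,t)+\sum_{k=0}^{n-2}I_k(q,t)\,I_{n-1-k}(q,qt).$$
   Context: $\mathrm{Av}_n(321)$ is the set of permutations $\sigma=a_1\ldots a_n$ of $[n]$ with no $i<j<k$ such that $a_i>a_j>a_k$ (for $n=0$, only the empty permutation). $\mathrm{inv}\,\sigma=\#\{(i,j):i<j,\ a_i>a_j\}$; $\mathrm{lrm}\,\sigma$ is the number of $i$ with $a_i=\max\{a_1,\dots,a_i\}$. Let $I_n(q,t)=\sum_{\sigma\in\mathrm{Av}_n(321)}q^{\mathrm{inv}\,\sigma}t^{\mathrm{lrm}\,\sigma}$, so $I_0(q,t)=1$; $I_m(q,qt)$ denotes this polynomial with $t$ replaced by $qt$. -}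

module Defs where

open import Level using (Level)
open import Data.Nat using (ℕ; zero; suc)
open import Data.Fin using (Fin; zero; suc; _<_; _≤_; _>_; _≟_; _<?_; _≤?_)
open import Data.Fin.Properties using (any?; all?)
open import Data.List using (List; []; _∷_; [_]; map; concatMap; filter; length; foldr; allFin)
open import Data.Product using (_×_; ∃; ∃-syntax; _,_)
open import Relation.Nullary using (¬_; Dec)
open import Relation.Nullary.Decidable using (_×-dec_; ¬?; _→-dec_)
open import Relation.Binary.PropositionalEquality using (_≡_)
open import Algebra.Bundles using (CommutativeSemiring)

consF : ∀ {n m} → Fin m → (Fin n → Fin m) → (Fin (suc n) → Fin m)
consF x f zero    = x
consF x f (suc i) = f i

allFuns : ∀ n m → List (Fin n → Fin m)
allFuns zero    m = [ (λ ()) ]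
allFuns (suc n) m = concatMap (λ f → map (λ x → consF x f) (allFin m)) (allFuns n m)

-- A word σ = σ(0) … σ(n-1) over Fin n (values 0..n-1 stand for 1..n).
IsInjective : ∀ {n} → (Fin n → Fin n) → Set
IsInjective {n} σ = ∀ (i j : Fin n) → σ i ≡ σ j → i ≡ j

Contains321 : ∀ {n} → (Fin n → Fin n) → Set
Contains321 {n} σ = ∃[ i ] ∃[ j ] ∃[ k ] ((i < j × j < k) × (σ i > σ j × σ j > σ k))

Av321 : ∀ {n} → (Fin n → Fin n) → Set
Av321 σ = IsInjective σ × ¬ Contains321 σ

injective? : ∀ {n} (σ : Fin n → Fin n) → Dec (IsInjective σ)
injective? σ = all? (λ i → all? (λ j → (σ i ≟ σ j) →-dec (i ≟ j)))

contains321? : ∀ {n} (σ : Fin n → Fin n) → Dec (Contains321 σ)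
contains321? σ = any? (λ i → any? (λ j → any? (λ k →
  ((i <? j) ×-dec (j <? k)) ×-dec ((σ j <? σ i) ×-dec (σ k <? σ j)))))

av321? : ∀ {n} (σ : Fin n → Fin n) → Dec (Av321 σ)
av321? σ = injective? σ ×-dec ¬? (contains321? σ)

Av321List : ∀ n → List (Fin n → Fin n)
Av321List n = filter av321? (allFuns n n)

inv : ∀ {n} → (Fin n → Fin n) → ℕ
inv {n} σ = length (filter (λ p → (Data.Product.proj₁ p <? Data.Product.proj₂ p)
                                  ×-dec (σ (Data.Product.proj₂ p) <? σ (Data.Product.proj₁ p)))
                           (concatMap (λ i → map (λ j → (i , j)) (allFin n)) (allFin n)))

lrm : ∀ {n} → (Fin n → Fin n) → ℕ
lrm {n} σ = length (filter (λ i → all? (λ j → (j ≤? i) →-dec (σ j ≤? σ i))) (allFin n))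

module _ {c ℓ : Level} (R : CommutativeSemiring c ℓ) where
  open CommutativeSemiring R

  pow : Carrier → ℕ → Carrier
  pow x zero    = 1#
  pow x (suc k) = x * pow x k

  sumR : List Carrier → Carrier
  sumR = foldr _+_ 0#

  I : Carrier → Carrier → ℕ → Carrier
  I q t n = sumR (map (λ σ → pow q (inv σ) * pow t (lrm σ)) (Av321List n))

-- Idea.  Read a permutation as the word of its values.  A word avoids 321 iff
-- its entries that are not left-to-right maxima increase, so while a word is
-- written only a state (c, b) matters: b bounds the maxima so far (the next
-- entry is a new maximum iff it is ≥ b) and c is a floor that every later
-- entry must reach.  The total weight q^inv t^lrm of all ways to finish a word
-- from a state depends only on the numbers k and e of unused values below and
-- above b.  It is the polynomial Φ t k e, defined by the recursion "either the
-- least unused value below b comes next, or some new maximum does" (the latter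
-- part is Ψ).  These polynomials satisfy the functional equation
--   Φ t (h+1) = Φ (q t) h ⋆ Φ t 0        (⋆ the Cauchy product),
-- and I_n = Φ t 0 n; unfolding Φ t 0 (n+2) once and applying the functional
-- equation to the new-maximum part gives the recurrence.
module Submission where

open import Defs
open import Level using (Level)
open import Data.Nat using (ℕ; zero; suc; _∸_)
open import Data.List using (map; upTo)
open import Algebra.Bundles using (CommutativeSemiring)

open import Function using (_∘_; id)
open import Function.Bundles using (mk⇔)
open import Function.Definitions using (Injective)
open import Data.Bool using (Bool; true; false; _∧_; _∨_; not; if_then_else_; T)
open import Data.Bool.Properties using (T-≡; T-∧; T-∨; ∧-zeroʳ; ∧-identityʳ)
open import Data.Unit using (tt; ⊤)
open import Data.Empty using (⊥-elim)
import Data.Nat as N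
open N using (_<ᵇ_; _≤ᵇ_; _≡ᵇ_; z≤n; s≤s)
import Data.Nat.Properties as NP
open import Data.List using (List; []; _∷_; _++_; concatMap; filter; filterᵇ; length; tabulate; allFin)
open import Data.Bool.ListAction using (any; all)
open import Data.Fin as F using (Fin; toℕ)
import Data.Fin.Properties as FP
import Data.Product
open Data.Product using (_×_; _,_; proj₁; proj₂; ∃-syntax)
import Data.Sum
open Data.Sum using (_⊎_; inj₁; inj₂; [_,_])
open import Relation.Nullary using (¬_; Dec; yes; no; does)
open import Relation.Nullary.Decidable using (does-⇔; T?; dec-true; dec-false)
open import Relation.Binary.PropositionalEquality as P using (_≡_; _≢_)
open import Data.List.Membership.Propositional using (_∈_)
open import Data.List.Relation.Unary.Any using (here; there)

open Function.Bundles.Equivalence using (to; from)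

T-ext : ∀ {x y} → (T x → T y) → (T y → T x) → x ≡ y
T-ext f g = does-⇔ (mk⇔ f g) (T? _) (T? _)

¬T⇒T-not : ∀ {x} → ¬ T x → T (not x)
¬T⇒T-not {true} h = h tt
¬T⇒T-not {false} h = tt

T-not⇒¬T : ∀ {x} → T (not x) → ¬ T x
T-not⇒¬T {true} ()

¬T-∨ : ∀ {x y} → ¬ T x → ¬ T y → ¬ T (x ∨ y)
¬T-∨ {x} ¬x ¬y t = [ ¬x , ¬y ] (to (T-∨ {x}) t)

¬T-∨⁻ : ∀ {x y} → ¬ T (x ∨ y) → ¬ T x × ¬ T y
¬T-∨⁻ {x} h = (λ t → h (from T-∨ (inj₁ t))) , (λ t → h (from (T-∨ {x}) (inj₂ t)))

≤ᵇ≡true⇒≤ : ∀ {b x} → (b ≤ᵇ x) ≡ true → b N.≤ x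
≤ᵇ≡true⇒≤ {b} {x} e = NP.≤ᵇ⇒≤ b x (from T-≡ e)

≤ᵇ≡false⇒> : ∀ {b x} → (b ≤ᵇ x) ≡ false → x N.< b
≤ᵇ≡false⇒> {b} {x} e = NP.≰⇒> (λ h → P.subst T e (NP.≤⇒≤ᵇ h))

≤⇒≤ᵇ≡true : ∀ {b x} → b N.≤ x → (b ≤ᵇ x) ≡ true
≤⇒≤ᵇ≡true h = dec-true (T? _) (NP.≤⇒≤ᵇ h)

>⇒≤ᵇ≡false : ∀ {b x} → x N.< b → (b ≤ᵇ x) ≡ false
>⇒≤ᵇ≡false {b} {x} h = dec-false (T? _) (λ t → NP.<⇒≱ h (NP.≤ᵇ⇒≤ b x t))

<⇒<ᵇ≡true : ∀ {a b} → a N.< b → (a <ᵇ b) ≡ true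
<⇒<ᵇ≡true h = dec-true (T? _) (NP.<⇒<ᵇ h)

≮⇒<ᵇ≡false : ∀ {a b} → ¬ a N.< b → (a <ᵇ b) ≡ false
≮⇒<ᵇ≡false {a} {b} h = dec-false (T? _) (h ∘ NP.<ᵇ⇒< a b)

≤ᵇ≡<ᵇ : ∀ {x y} → x ≢ y → (x ≤ᵇ y) ≡ (x <ᵇ y)
≤ᵇ≡<ᵇ {x} {y} x≢y = T-ext (λ t → NP.<⇒<ᵇ (NP.≤∧≢⇒< (NP.≤ᵇ⇒≤ x y t) x≢y))
                          (λ t → NP.≤⇒≤ᵇ (NP.<⇒≤ (NP.<ᵇ⇒< x y t)))

≡ᵇ-refl : ∀ x → (x ≡ᵇ x) ≡ true
≡ᵇ-refl x = dec-true (T? _) (NP.≡⇒≡ᵇ x x P.refl)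

≡ᵇ-sym : ∀ x y → (x ≡ᵇ y) ≡ (y ≡ᵇ x)
≡ᵇ-sym x y = T-ext (λ t → NP.≡⇒≡ᵇ y x (P.sym (NP.≡ᵇ⇒≡ x y t)))
                   (λ t → NP.≡⇒≡ᵇ x y (P.sym (NP.≡ᵇ⇒≡ y x t)))

≡ᵇ≡true⇒≡ : ∀ x y → (x ≡ᵇ y) ≡ true → x ≡ y
≡ᵇ≡true⇒≡ x y e = NP.≡ᵇ⇒≡ x y (from T-≡ e)

≡ᵇ≡false⇒≢ : ∀ x y → (x ≡ᵇ y) ≡ false → x ≢ y
≡ᵇ≡false⇒≢ x y e x≡y = P.subst T e (NP.≡⇒≡ᵇ x y x≡y)

-- §1  Words over ℕ and their statistics

countᵇ : ∀ {a} {A : Set a} → (A → Bool) → List A → ℕ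
countᵇ p [] = 0
countᵇ p (x ∷ xs) = if p x then suc (countᵇ p xs) else countᵇ p xs

_∈ᵇ_ : ℕ → List ℕ → Bool
x ∈ᵇ [] = false
x ∈ᵇ (y ∷ w) = (x ≡ᵇ y) ∨ (x ∈ᵇ w)

distinctᵇ : List ℕ → Bool
distinctᵇ [] = true
distinctᵇ (x ∷ w) = not (x ∈ᵇ w) ∧ distinctᵇ w

∈ᵇ-here : ∀ x L → T (x ∈ᵇ (x ∷ L))
∈ᵇ-here x L = from T-∨ (inj₁ (NP.≡⇒≡ᵇ x x P.refl))

∈ᵇ-there : ∀ y x L → T (y ∈ᵇ L) → T (y ∈ᵇ (x ∷ L))
∈ᵇ-there y x L t = from (T-∨ {y ≡ᵇ x}) (inj₂ t)

∈ᵇ-∷⁻ : ∀ y x L → T (y ∈ᵇ (x ∷ L)) → y ≡ x ⊎ T (y ∈ᵇ L)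
∈ᵇ-∷⁻ y x L t = Data.Sum.map₁ (NP.≡ᵇ⇒≡ y x) (to (T-∨ {y ≡ᵇ x}) t)

∈⇒∈ᵇ : ∀ {x L} → x ∈ L → T (x ∈ᵇ L)
∈⇒∈ᵇ {x} {y ∷ L} (here P.refl) = ∈ᵇ-here x L
∈⇒∈ᵇ {x} {y ∷ L} (there x∈) = ∈ᵇ-there x y L (∈⇒∈ᵇ x∈)

anyBelow : ℕ → List ℕ → Bool
anyBelow y = any (_<ᵇ y)

has21Below : ℕ → List ℕ → Bool
has21Below x [] = false
has21Below x (y ∷ w) = ((y <ᵇ x) ∧ anyBelow y w) ∨ has21Below x w

has321 : List ℕ → Bool
has321 [] = false
has321 (x ∷ w) = has21Below x w ∨ has321 w

invW : List ℕ → ℕ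
invW [] = 0
invW (x ∷ w) = countᵇ (_<ᵇ x) w N.+ invW w

raise : ℕ → ℕ → ℕ
raise b x = if b ≤ᵇ x then x else b

lrmW : ℕ → List ℕ → ℕ
lrmW b [] = 0
lrmW b (x ∷ w) = if b ≤ᵇ x then suc (lrmW (raise b x) w) else lrmW (raise b x) w

word : ∀ {n m} → (Fin n → Fin m) → List ℕ
word σ = map toℕ (tabulate σ)

-- §2  The statistics of Defs are the word statistics

module Translation where
  open N using (_+_)
  open import Data.Nat.ListAction using (sum)
  import Data.List.Properties as LP

  countFin : ∀ {n} → (Fin n → Bool) → ℕ
  countFin {zero} p = 0
  countFin {suc n} p = if p F.zero then suc (countFin (p ∘ F.suc)) else countFin (p ∘ F.suc)

  sumFin : ∀ {n} → (Fin n → ℕ) → ℕ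
  sumFin {zero} g = 0
  sumFin {suc n} g = g F.zero + sumFin (g ∘ F.suc)

  countᵇ-filter : ∀ {a p} {A : Set a} {P : A → Set p} (P? : ∀ x → Dec (P x)) xs →
                  length (filter P? xs) ≡ countᵇ (does ∘ P?) xs
  countᵇ-filter P? [] = P.refl
  countᵇ-filter P? (x ∷ xs) with does (P? x)
  ... | true = P.cong suc (countᵇ-filter P? xs)
  ... | false = countᵇ-filter P? xs

  countᵇ-++ : ∀ {a} {A : Set a} (p : A → Bool) xs ys → countᵇ p (xs ++ ys) ≡ countᵇ p xs + countᵇ p ys
  countᵇ-++ p [] ys = P.refl
  countᵇ-++ p (x ∷ xs) ys with p x
  ... | true = P.cong suc (countᵇ-++ p xs ys)
  ... | false = countᵇ-++ p xs ys

  countᵇ-concatMap : ∀ {a b} {A : Set a} {B : Set b} (p : B → Bool) (f : A → List B) xs →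
                     countᵇ p (concatMap f xs) ≡ sum (map (countᵇ p ∘ f) xs)
  countᵇ-concatMap p f [] = P.refl
  countᵇ-concatMap p f (x ∷ xs) =
    P.trans (countᵇ-++ p (f x) (concatMap f xs)) (P.cong (countᵇ p (f x) +_) (countᵇ-concatMap p f xs))

  countᵇ-map : ∀ {a b} {A : Set a} {B : Set b} (p : B → Bool) (g : A → B) xs →
               countᵇ p (map g xs) ≡ countᵇ (p ∘ g) xs
  countᵇ-map p g [] = P.refl
  countᵇ-map p g (x ∷ xs) with p (g x)
  ... | true = P.cong suc (countᵇ-map p g xs)
  ... | false = countᵇ-map p g xs

  countᵇ-tabulate : ∀ {a} {A : Set a} {n} (p : A → Bool) (f : Fin n → A) →
                    countᵇ p (tabulate f) ≡ countFin (p ∘ f)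
  countᵇ-tabulate {n = zero} p f = P.refl
  countᵇ-tabulate {n = suc n} p f with p (f F.zero)
  ... | true = P.cong suc (countᵇ-tabulate p (f ∘ F.suc))
  ... | false = countᵇ-tabulate p (f ∘ F.suc)

  sum-tabulate : ∀ {n} (g : Fin n → ℕ) → sum (tabulate g) ≡ sumFin g
  sum-tabulate {zero} g = P.refl
  sum-tabulate {suc n} g = P.cong (g F.zero +_) (sum-tabulate (g ∘ F.suc))

  countᵇ-word : ∀ {n m} (p : ℕ → Bool) (τ : Fin n → Fin m) → countᵇ p (word τ) ≡ countFin (p ∘ toℕ ∘ τ)
  countᵇ-word p τ = P.trans (countᵇ-map p toℕ (tabulate τ)) (countᵇ-tabulate (p ∘ toℕ) τ)

  invFin : ∀ {n m} → (Fin n → Fin m) → ℕ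
  invFin σ = sumFin (λ i → countFin (λ j → (toℕ i <ᵇ toℕ j) ∧ (toℕ (σ j) <ᵇ toℕ (σ i))))

  invFin≡invW : ∀ {n m} (σ : Fin n → Fin m) → invFin σ ≡ invW (word σ)
  invFin≡invW {zero} σ = P.refl
  invFin≡invW {suc n} σ =
    P.cong₂ _+_ (P.sym (countᵇ-word (_<ᵇ toℕ (σ F.zero)) (σ ∘ F.suc))) (invFin≡invW (σ ∘ F.suc))

  inv≡invW : ∀ {n} (σ : Fin n → Fin n) → inv σ ≡ invW (word σ)
  inv≡invW {n} σ = begin
    inv σ                                            ≡⟨ countᵇ-filter _ pairs ⟩
    countᵇ isInv pairs                               ≡⟨ countᵇ-concatMap isInv row (allFin n) ⟩
    sum (map (countᵇ isInv ∘ row) (allFin n))        ≡⟨ P.cong sum (LP.map-cong rowCount (allFin n)) ⟩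
    sum (map (λ i → countFin (λ j → isInv (i , j))) (allFin n))
                                                     ≡⟨ P.cong sum (LP.map-tabulate {n = n} id _) ⟩
    sum (tabulate (λ i → countFin (λ j → isInv (i , j))))
                                                     ≡⟨ sum-tabulate {n} _ ⟩
    invFin σ                                         ≡⟨ invFin≡invW σ ⟩
    invW (word σ)                                    ∎
    where
    open P.≡-Reasoning
    row : Fin n → List (Fin n × Fin n)
    row i = map (i ,_) (allFin n)
    pairs = concatMap row (allFin n)
    isInv : Fin n × Fin n → Bool
    isInv (i , j) = (toℕ i <ᵇ toℕ j) ∧ (toℕ (σ j) <ᵇ toℕ (σ i))
    rowCount : ∀ i → countᵇ isInv (row i) ≡ countFin (λ j → isInv (i , j))
    rowCount i = P.trans (countᵇ-map isInv (i ,_) (allFin n)) (countᵇ-tabulate (λ j → isInv (i , j)) id)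

  IsLrm : ∀ {n m} → ℕ → (Fin n → Fin m) → Fin n → Set
  IsLrm b σ i = (b N.≤ toℕ (σ i)) × (∀ j → j F.≤ i → σ j F.≤ σ i)

  isLrm? : ∀ {n m} b (σ : Fin n → Fin m) i → Dec (IsLrm b σ i)
  isLrm? b σ i = (b NP.≤? toℕ (σ i)) ×-dec FP.all? (λ j → (j FP.≤? i) →-dec (σ j FP.≤? σ i))
    where open import Relation.Nullary.Decidable using (_×-dec_; _→-dec_)

  lrm≡countLrm : ∀ {n} (σ : Fin n → Fin n) → lrm σ ≡ countFin (does ∘ isLrm? 0 σ)
  lrm≡countLrm {n} σ = P.trans (countᵇ-filter _ (allFin n)) (countᵇ-tabulate {n = n} _ id)

  raise-≤⁺ : ∀ b x {y} → b N.≤ y → x N.≤ y → raise b x N.≤ y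
  raise-≤⁺ b x b≤y x≤y with b ≤ᵇ x
  ... | true = x≤y
  ... | false = b≤y

  raise-≤⁻ : ∀ b x {y} → raise b x N.≤ y → b N.≤ y × x N.≤ y
  raise-≤⁻ b x h with b ≤ᵇ x in e
  ... | true = NP.≤-trans (≤ᵇ≡true⇒≤ e) h , h
  ... | false = h , NP.≤-trans (NP.<⇒≤ (≤ᵇ≡false⇒> e)) h

  isLrm?-zero : ∀ {n m} b (σ : Fin (suc n) → Fin m) → does (isLrm? b σ F.zero) ≡ (b ≤ᵇ toℕ (σ F.zero))
  isLrm?-zero b σ = does-⇔ (mk⇔ proj₁ (λ h → h , λ { F.zero _ → NP.≤-refl }))
                           (isLrm? b σ F.zero) (b NP.≤? toℕ (σ F.zero))

  isLrm?-suc : ∀ {n m} b (σ : Fin (suc n) → Fin m) i →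
               does (isLrm? b σ (F.suc i)) ≡ does (isLrm? (raise b (toℕ (σ F.zero))) (σ ∘ F.suc) i)
  isLrm?-suc b σ i = does-⇔ (mk⇔ forth back) (isLrm? b σ (F.suc i)) (isLrm? _ (σ ∘ F.suc) i)
    where
    forth : IsLrm b σ (F.suc i) → IsLrm (raise b (toℕ (σ F.zero))) (σ ∘ F.suc) i
    forth (b≤ , max) = raise-≤⁺ b _ b≤ (max F.zero z≤n) , λ j j≤i → max (F.suc j) (s≤s j≤i)
    back : IsLrm (raise b (toℕ (σ F.zero))) (σ ∘ F.suc) i → IsLrm b σ (F.suc i)
    back (r≤ , max) = proj₁ (raise-≤⁻ b _ r≤) , λ { F.zero _ → proj₂ (raise-≤⁻ b _ r≤)
                                                 ; (F.suc j) (s≤s j≤i) → max j j≤i }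

  countFin-cong : ∀ {n} {p p′ : Fin n → Bool} → (∀ i → p i ≡ p′ i) → countFin p ≡ countFin p′
  countFin-cong {zero} e = P.refl
  countFin-cong {suc n} e rewrite e F.zero | countFin-cong (e ∘ F.suc) = P.refl

  countLrm≡lrmW : ∀ {n m} b (σ : Fin n → Fin m) → countFin (does ∘ isLrm? b σ) ≡ lrmW b (word σ)
  countLrm≡lrmW {zero} b σ = P.refl
  countLrm≡lrmW {suc n} b σ
    rewrite isLrm?-zero b σ
          | countFin-cong (isLrm?-suc b σ)
          | countLrm≡lrmW (raise b (toℕ (σ F.zero))) (σ ∘ F.suc) = P.refl

  lrm≡lrmW : ∀ {n} (σ : Fin n → Fin n) → lrm σ ≡ lrmW 0 (word σ)
  lrm≡lrmW σ = P.trans (lrm≡countLrm σ) (countLrm≡lrmW 0 σ)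

  any-word⁻ : ∀ {n m} (p : ℕ → Bool) (τ : Fin n → Fin m) → T (any p (word τ)) → ∃[ j ] T (p (toℕ (τ j)))
  any-word⁻ {suc n} p τ t with to (T-∨ {p (toℕ (τ F.zero))}) t
  ... | inj₁ h = F.zero , h
  ... | inj₂ h with any-word⁻ p (τ ∘ F.suc) h
  ... | j , hj = F.suc j , hj

  any-word⁺ : ∀ {n m} (p : ℕ → Bool) (τ : Fin n → Fin m) j → T (p (toℕ (τ j))) → T (any p (word τ))
  any-word⁺ p τ F.zero h = from T-∨ (inj₁ h)
  any-word⁺ p τ (F.suc j) h = from (T-∨ {p (toℕ (τ F.zero))}) (inj₂ (any-word⁺ p (τ ∘ F.suc) j h))

  ∈ᵇ≡any : ∀ x w → (x ∈ᵇ w) ≡ any (x ≡ᵇ_) w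
  ∈ᵇ≡any x [] = P.refl
  ∈ᵇ≡any x (y ∷ w) = P.cong ((x ≡ᵇ y) ∨_) (∈ᵇ≡any x w)

  ∈ᵇ-word⁻ : ∀ {n m} x (τ : Fin n → Fin m) → T (x ∈ᵇ word τ) → ∃[ j ] toℕ (τ j) ≡ x
  ∈ᵇ-word⁻ x τ t with any-word⁻ (x ≡ᵇ_) τ (P.subst T (∈ᵇ≡any x (word τ)) t)
  ... | j , h = j , P.sym (NP.≡ᵇ⇒≡ x _ h)

  ∈ᵇ-word⁺ : ∀ {n m} x (τ : Fin n → Fin m) j → toℕ (τ j) ≡ x → T (x ∈ᵇ word τ)
  ∈ᵇ-word⁺ x τ j e =
    P.subst T (P.sym (∈ᵇ≡any x (word τ))) (any-word⁺ (x ≡ᵇ_) τ j (NP.≡⇒≡ᵇ x _ (P.sym e)))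

  injective⇒distinct : ∀ {n m} (σ : Fin n → Fin m) → Injective _≡_ _≡_ σ → T (distinctᵇ (word σ))
  injective⇒distinct {zero} σ inj = tt
  injective⇒distinct {suc n} σ inj =
    from T-∧ (¬T⇒T-not firstNew , injective⇒distinct (σ ∘ F.suc) (FP.suc-injective ∘ inj))
    where
    firstNew : ¬ T (toℕ (σ F.zero) ∈ᵇ word (σ ∘ F.suc))
    firstNew t with ∈ᵇ-word⁻ _ (σ ∘ F.suc) t
    ... | j , e with inj (FP.toℕ-injective e)
    ... | ()

  distinct⇒injective : ∀ {n m} (σ : Fin n → Fin m) → T (distinctᵇ (word σ)) → Injective _≡_ _≡_ σ
  distinct⇒injective σ d {F.zero} {F.zero} e = P.refl
  distinct⇒injective σ d {F.zero} {F.suc j} e =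
    ⊥-elim (T-not⇒¬T (proj₁ (to T-∧ d)) (∈ᵇ-word⁺ _ (σ ∘ F.suc) j (P.cong toℕ (P.sym e))))
  distinct⇒injective σ d {F.suc i} {F.zero} e =
    ⊥-elim (T-not⇒¬T (proj₁ (to T-∧ d)) (∈ᵇ-word⁺ _ (σ ∘ F.suc) i (P.cong toℕ e)))
  distinct⇒injective σ d {F.suc i} {F.suc j} e =
    P.cong F.suc (distinct⇒injective (σ ∘ F.suc) (proj₂ (to (T-∧ {not _}) d)) e)

  -- Patterns 21 with larger entry below x, and patterns 321 (Contains321 of
  -- Defs, for maps Fin n → Fin m so that induction can drop position 0).
  Has21Below : ∀ {n m} → ℕ → (Fin n → Fin m) → Set
  Has21Below x τ = ∃[ j ] ∃[ k ] (j F.< k × toℕ (τ j) N.< x × toℕ (τ k) N.< toℕ (τ j))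

  Has321 : ∀ {n m} → (Fin n → Fin m) → Set
  Has321 σ = ∃[ i ] ∃[ j ] ∃[ k ] ((i F.< j × j F.< k) × (σ i F.> σ j × σ j F.> σ k))

  has21Below-word⁻ : ∀ {n m} x (τ : Fin n → Fin m) → T (has21Below x (word τ)) → Has21Below x τ
  has21Below-word⁻ {suc n} x τ t with to (T-∨ {(toℕ (τ F.zero) <ᵇ x) ∧ _}) t
  ... | inj₁ h with to (T-∧ {toℕ (τ F.zero) <ᵇ x}) h
  ... | lt , below with any-word⁻ (_<ᵇ toℕ (τ F.zero)) (τ ∘ F.suc) below
  ... | k , lt′ = F.zero , F.suc k , s≤s z≤n , NP.<ᵇ⇒< _ x lt , NP.<ᵇ⇒< _ _ lt′
  has21Below-word⁻ {suc n} x τ t | inj₂ h with has21Below-word⁻ x (τ ∘ F.suc) h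
  ... | j , k , j<k , p , q = F.suc j , F.suc k , s≤s j<k , p , q

  has21Below-word⁺ : ∀ {n m} x (τ : Fin n → Fin m) → Has21Below x τ → T (has21Below x (word τ))
  has21Below-word⁺ x τ (F.zero , F.suc k , _ , p , q) =
    from T-∨ (inj₁ (from T-∧ (NP.<⇒<ᵇ p , any-word⁺ (_<ᵇ toℕ (τ F.zero)) (τ ∘ F.suc) k (NP.<⇒<ᵇ q))))
  has21Below-word⁺ x τ (F.suc j , F.suc k , s≤s j<k , p , q) =
    from (T-∨ {(toℕ (τ F.zero) <ᵇ x) ∧ _}) (inj₂ (has21Below-word⁺ x (τ ∘ F.suc) (j , k , j<k , p , q)))

  has321-word⁻ : ∀ {n m} (σ : Fin n → Fin m) → T (has321 (word σ)) → Has321 σ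
  has321-word⁻ {suc n} σ t with to (T-∨ {has21Below (toℕ (σ F.zero)) (word (σ ∘ F.suc))}) t
  ... | inj₁ h with has21Below-word⁻ _ (σ ∘ F.suc) h
  ... | j , k , j<k , p , q = F.zero , F.suc j , F.suc k , (s≤s z≤n , s≤s j<k) , p , q
  has321-word⁻ {suc n} σ t | inj₂ h with has321-word⁻ (σ ∘ F.suc) h
  ... | i , j , k , (i<j , j<k) , p , q = F.suc i , F.suc j , F.suc k , (s≤s i<j , s≤s j<k) , p , q

  has321-word⁺ : ∀ {n m} (σ : Fin n → Fin m) → Has321 σ → T (has321 (word σ))
  has321-word⁺ σ (F.zero , F.suc j , F.suc k , (_ , s≤s j<k) , p , q) =
    from T-∨ (inj₁ (has21Below-word⁺ _ (σ ∘ F.suc) (j , k , j<k , p , q)))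
  has321-word⁺ σ (F.suc i , F.suc j , F.suc k , (s≤s i<j , s≤s j<k) , p , q) =
    from (T-∨ {has21Below (toℕ (σ F.zero)) (word (σ ∘ F.suc))})
         (inj₂ (has321-word⁺ (σ ∘ F.suc) (i , j , k , (i<j , j<k) , p , q)))

  av321?-word : ∀ {n} (σ : Fin n → Fin n) → does (av321? σ) ≡ (distinctᵇ (word σ) ∧ not (has321 (word σ)))
  av321?-word σ = P.cong₂ (λ a b → a ∧ not b)
    (does-⇔ (mk⇔ (λ inj → injective⇒distinct σ (λ {i} {j} → inj i j))
                 (λ d i j → distinct⇒injective σ d)) (injective? σ) (T? _))
    (does-⇔ (mk⇔ (has321-word⁺ σ) (has321-word⁻ σ)) (contains321? σ) (T? _))

-- §3  Reading a 321-avoiding word from a state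

-- A word w is 321-avoiding iff its entries that are not left-to-right maxima
-- increase.  Scanning w, we keep the maximum bound b and a floor c below
-- which no later entry may lie: an entry x < b is not a maximum, so all
-- later entries must exceed x.

nextFloor : ℕ → ℕ → ℕ → ℕ
nextFloor c b x = if b ≤ᵇ x then c else suc x

avoidsFrom : ℕ → ℕ → List ℕ → Bool
avoidsFrom c b [] = true
avoidsFrom c b (x ∷ w) = (c ≤ᵇ x) ∧ avoidsFrom (nextFloor c b x) (raise b x) w

Avoiding : ℕ → ℕ → List ℕ → Set
Avoiding c b w = ¬ T (has321 w) × ¬ T (anyBelow c w) × ¬ T (has21Below b w)

module Avoidance where

  anyBelow-mono : ∀ {a b} w → a N.≤ b → T (anyBelow a w) → T (anyBelow b w)
  anyBelow-mono {a} {b} (y ∷ w) a≤b t with to (T-∨ {y <ᵇ a}) t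
  ... | inj₁ h = from T-∨ (inj₁ (NP.<⇒<ᵇ (NP.<-≤-trans (NP.<ᵇ⇒< y a h) a≤b)))
  ... | inj₂ h = from (T-∨ {y <ᵇ b}) (inj₂ (anyBelow-mono w a≤b h))

  has21Below-mono : ∀ {a b} w → a N.≤ b → T (has21Below a w) → T (has21Below b w)
  has21Below-mono {a} (y ∷ w) a≤b t with to (T-∨ {(y <ᵇ a) ∧ anyBelow y w}) t
  ... | inj₁ h with to (T-∧ {y <ᵇ a}) h
  ... | y<a , below = from T-∨ (inj₁ (from T-∧ (NP.<⇒<ᵇ (NP.<-≤-trans (NP.<ᵇ⇒< y a y<a) a≤b) , below)))
  has21Below-mono {a} {b} (y ∷ w) a≤b t | inj₂ h =
    from (T-∨ {(y <ᵇ b) ∧ anyBelow y w}) (inj₂ (has21Below-mono w a≤b h))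

  has21Below⇒anyBelow : ∀ {z} w → T (has21Below z w) → T (anyBelow z w)
  has21Below⇒anyBelow {z} (y ∷ w) t with to (T-∨ {(y <ᵇ z) ∧ anyBelow y w}) t
  ... | inj₁ h = from T-∨ (inj₁ (proj₁ (to (T-∧ {y <ᵇ z}) h)))
  ... | inj₂ h = from (T-∨ {y <ᵇ z}) (inj₂ (has21Below⇒anyBelow w h))

  anyBelow-suc : ∀ {z} w → T (anyBelow (suc z) w) → T (anyBelow z w) ⊎ T (z ∈ᵇ w)
  anyBelow-suc {z} (y ∷ w) t with to (T-∨ {y <ᵇ suc z}) t
  ... | inj₂ h = Data.Sum.map (λ u → from (T-∨ {y <ᵇ z}) (inj₂ u)) (λ u → from (T-∨ {z ≡ᵇ y}) (inj₂ u))
                              (anyBelow-suc w h)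
  ... | inj₁ h with NP.m≤n⇒m<n∨m≡n (NP.≤-pred (NP.<ᵇ⇒< y (suc z) h))
  ... | inj₁ y<z = inj₁ (from T-∨ (inj₁ (NP.<⇒<ᵇ y<z)))
  ... | inj₂ y≡z = inj₂ (from T-∨ (inj₁ (NP.≡⇒≡ᵇ z y (P.sym y≡z))))

  avoidsFrom-sound : ∀ c b w → T (avoidsFrom c b w) → Avoiding c b w
  avoidsFrom-sound c b [] v = (λ ()) , (λ ()) , (λ ())
  avoidsFrom-sound c b (z ∷ w) v with to (T-∧ {c ≤ᵇ z}) v
  ... | c≤ᵇz , v′ with b ≤ᵇ z in e
  ... | true with avoidsFrom-sound c z w v′
  ...   | no321 , noBelow , no21 =
          ¬T-∨ no21 no321 ,
          ¬T-∨ (λ z<c → NP.<⇒≱ (NP.<ᵇ⇒< z c z<c) c≤z) noBelow ,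
          ¬T-∨ (λ h → NP.<⇒≱ (NP.<ᵇ⇒< z b (proj₁ (to (T-∧ {z <ᵇ b}) h))) (≤ᵇ≡true⇒≤ e))
               (no21 ∘ has21Below-mono w (≤ᵇ≡true⇒≤ e))
    where c≤z = NP.≤ᵇ⇒≤ c z c≤ᵇz
  avoidsFrom-sound c b (z ∷ w) v | c≤ᵇz , v′ | false with avoidsFrom-sound (suc z) b w v′
  ...   | no321 , noBelow , no21 =
          ¬T-∨ (noBelow ∘ anyBelow-mono w (NP.n≤1+n z) ∘ has21Below⇒anyBelow w) no321 ,
          ¬T-∨ (λ z<c → NP.<⇒≱ (NP.<ᵇ⇒< z c z<c) c≤z) (noBelow ∘ anyBelow-mono w (NP.m≤n⇒m≤1+n c≤z)) ,
          ¬T-∨ (noBelow ∘ anyBelow-mono w (NP.n≤1+n z) ∘ proj₂ ∘ to (T-∧ {z <ᵇ b})) no21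
    where c≤z = NP.≤ᵇ⇒≤ c z c≤ᵇz

  -- The converse needs distinct letters: after an entry z < b the floor
  -- becomes z + 1, and z itself cannot occur again.
  avoidsFrom-complete : ∀ c b w → T (distinctᵇ w) → Avoiding c b w → T (avoidsFrom c b w)
  avoidsFrom-complete c b [] d _ = tt
  avoidsFrom-complete c b (z ∷ w) d (no321 , noBelow , no21)
    with to (T-∧ {not (z ∈ᵇ w)}) d | ¬T-∨⁻ {has21Below z w} no321 | ¬T-∨⁻ {z <ᵇ c} noBelow
       | ¬T-∨⁻ {(z <ᵇ b) ∧ anyBelow z w} no21
  ... | z∉w , dw | no21z , no321w | z≮c , noBelow-w | no21b-z , no21b-w with b ≤ᵇ z in e
  ... | true = from T-∧ (c≤z , avoidsFrom-complete c z w dw (no321w , noBelow-w , no21z))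
    where c≤z = NP.≤⇒≤ᵇ (NP.≮⇒≥ {z} {c} (z≮c ∘ NP.<⇒<ᵇ))
  ... | false = from T-∧ (c≤z , avoidsFrom-complete (suc z) b w dw (no321w , noBelow-z , no21b-w))
    where
    c≤z = NP.≤⇒≤ᵇ (NP.≮⇒≥ {z} {c} (z≮c ∘ NP.<⇒<ᵇ))
    noBelow-z : ¬ T (anyBelow (suc z) w)
    noBelow-z t = [ (λ u → no21b-z (from (T-∧ {z <ᵇ b}) (NP.<⇒<ᵇ (≤ᵇ≡false⇒> {b} {z} e) , u)))
                  , T-not⇒¬T z∉w ] (anyBelow-suc w t)

  avoidsFrom-initial : ∀ w → T (distinctᵇ w) → avoidsFrom 0 0 w ≡ not (has321 w)
  avoidsFrom-initial w d = T-ext (λ v → ¬T⇒T-not (proj₁ (avoidsFrom-sound 0 0 w v)))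
                                 (λ t → avoidsFrom-complete 0 0 w d (T-not⇒¬T t , nothingBelow0 w , no21Below0 w))
    where
    nothingBelow0 : ∀ w → ¬ T (anyBelow 0 w)
    nothingBelow0 (y ∷ w) = ¬T-∨ (λ ()) (nothingBelow0 w)
    no21Below0 : ∀ w → ¬ T (has21Below 0 w)
    no21Below0 (y ∷ w) = ¬T-∨ (λ ()) (no21Below0 w)

-- §4  Sets of unused values

range : ℕ → ℕ → List ℕ
range a zero = []
range a (suc m) = a ∷ range (suc a) m

available : ℕ → (ℕ → Bool) → List ℕ
available m p = filterᵇ p (range 0 m)

without : (ℕ → Bool) → ℕ → ℕ → Bool
without p x v = p v ∧ not (v ≡ᵇ x)

remove : ℕ → List ℕ → List ℕ
remove x = filterᵇ (λ v → not (v ≡ᵇ x))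

Increasing : List ℕ → Set
Increasing [] = ⊤
Increasing (x ∷ xs) = (∀ y → T (y ∈ᵇ xs) → x N.< y) × Increasing xs

valid : (ℕ → Bool) → ℕ → ℕ → List ℕ → Bool
valid p c b [] = true
valid p c b (x ∷ w) = p x ∧ ((c ≤ᵇ x) ∧ valid (without p x) (nextFloor c b x) (raise b x) w)

module AvailableSets where
  open N using (_+_)
  open Avoidance using (avoidsFrom-initial)

  ∈ᵇ-filter⁻ : ∀ p y L → T (y ∈ᵇ filterᵇ p L) → T (y ∈ᵇ L) × T (p y)
  ∈ᵇ-filter⁻ p y (x ∷ L) t with p x in e
  ... | false = Data.Product.map₁ (∈ᵇ-there y x L) (∈ᵇ-filter⁻ p y L t)
  ... | true with ∈ᵇ-∷⁻ y x (filterᵇ p L) t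
  ... | inj₁ P.refl = ∈ᵇ-here x L , from T-≡ e
  ... | inj₂ h = Data.Product.map₁ (∈ᵇ-there y x L) (∈ᵇ-filter⁻ p y L h)

  ∈ᵇ-filter⁺ : ∀ p y L → T (y ∈ᵇ L) → T (p y) → T (y ∈ᵇ filterᵇ p L)
  ∈ᵇ-filter⁺ p y (x ∷ L) t py with ∈ᵇ-∷⁻ y x L t
  ... | inj₁ P.refl rewrite dec-true (T? (p y)) py = ∈ᵇ-here y (filterᵇ p L)
  ... | inj₂ h with p x
  ...   | true = ∈ᵇ-there y x (filterᵇ p L) (∈ᵇ-filter⁺ p y L h py)
  ...   | false = ∈ᵇ-filter⁺ p y L h py

  ∈ᵇ-range⁻ : ∀ y a m → T (y ∈ᵇ range a m) → a N.≤ y × y N.< a + m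
  ∈ᵇ-range⁻ y a (suc m) t with ∈ᵇ-∷⁻ y a (range (suc a) m) t
  ... | inj₁ P.refl = NP.≤-refl , NP.m<m+n a (s≤s z≤n)
  ... | inj₂ h with ∈ᵇ-range⁻ y (suc a) m h
  ...   | a<y , y<end = NP.<⇒≤ a<y , P.subst (y N.<_) (P.sym (NP.+-suc a m)) y<end

  ∈ᵇ-range⁺ : ∀ y a m → a N.≤ y → y N.< a + m → T (y ∈ᵇ range a m)
  ∈ᵇ-range⁺ y a zero a≤y y<a = ⊥-elim (NP.<⇒≱ y<a (P.subst (N._≤ y) (P.sym (NP.+-identityʳ a)) a≤y))
  ∈ᵇ-range⁺ y a (suc m) a≤y y<end with NP.m≤n⇒m<n∨m≡n a≤y
  ... | inj₂ P.refl = ∈ᵇ-here a (range (suc a) m)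
  ... | inj₁ a<y = ∈ᵇ-there y a (range (suc a) m) (∈ᵇ-range⁺ y (suc a) m a<y (P.subst (y N.<_) (NP.+-suc a m) y<end))

  ∈ᵇ-available⁺ : ∀ m p y → y N.< m → T (p y) → T (y ∈ᵇ available m p)
  ∈ᵇ-available⁺ m p y y<m py = ∈ᵇ-filter⁺ p y (range 0 m) (∈ᵇ-range⁺ y 0 m z≤n y<m) py

  range-increasing : ∀ a m → Increasing (range a m)
  range-increasing a zero = tt
  range-increasing a (suc m) = (λ y t → proj₁ (∈ᵇ-range⁻ y (suc a) m t)) , range-increasing (suc a) m

  filter-increasing : ∀ p L → Increasing L → Increasing (filterᵇ p L)
  filter-increasing p [] inc = tt
  filter-increasing p (x ∷ L) (x<L , inc) with p x
  ... | true = (λ y t → x<L y (proj₁ (∈ᵇ-filter⁻ p y L t))) , filter-increasing p L inc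
  ... | false = filter-increasing p L inc

  increasing⇒distinct : ∀ L → Increasing L → T (distinctᵇ L)
  increasing⇒distinct [] inc = tt
  increasing⇒distinct (x ∷ L) (x<L , inc) =
    from T-∧ (¬T⇒T-not (λ t → NP.<-irrefl P.refl (x<L x t)) , increasing⇒distinct L inc)

  available-increasing : ∀ m p → Increasing (available m p)
  available-increasing m p = filter-increasing p (range 0 m) (range-increasing 0 m)

  available-distinct : ∀ m p → T (distinctᵇ (available m p))
  available-distinct m p = increasing⇒distinct (available m p) (available-increasing m p)

  remove-absent : ∀ x L → ¬ T (x ∈ᵇ L) → remove x L ≡ L
  remove-absent x [] _ = P.refl
  remove-absent x (y ∷ L) x∉ with ¬T-∨⁻ {x ≡ᵇ y} x∉
  ... | x≢y , x∉L rewrite ≡ᵇ-sym y x | dec-false (T? (x ≡ᵇ y)) x≢y =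
    P.cong (y ∷_) (remove-absent x L x∉L)

  remove-head : ∀ x L → remove x (x ∷ L) ≡ remove x L
  remove-head x L rewrite ≡ᵇ-refl x = P.refl

  ∈ᵇ-remove : ∀ x z L → T (z ∈ᵇ L) → z ≢ x → T (z ∈ᵇ remove x L)
  ∈ᵇ-remove x z L t z≢x = ∈ᵇ-filter⁺ _ z L t (¬T⇒T-not (z≢x ∘ NP.≡ᵇ⇒≡ z x))

  filter-distinct : ∀ p L → T (distinctᵇ L) → T (distinctᵇ (filterᵇ p L))
  filter-distinct p [] d = tt
  filter-distinct p (x ∷ L) d with to (T-∧ {not (x ∈ᵇ L)}) d
  ... | x∉L , dL with p x
  ...   | true = from T-∧ (¬T⇒T-not (T-not⇒¬T x∉L ∘ proj₁ ∘ ∈ᵇ-filter⁻ p x L) , filter-distinct p L dL)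
  ...   | false = filter-distinct p L dL

  count-remove : ∀ (f : ℕ → Bool) x L → T (distinctᵇ L) → T (x ∈ᵇ L) →
                 countᵇ f L ≡ (if f x then suc (countᵇ f (remove x L)) else countᵇ f (remove x L))
  count-remove f x (y ∷ L) d x∈ with to (T-∧ {not (y ∈ᵇ L)}) d | ∈ᵇ-∷⁻ x y L x∈
  ... | y∉L , dL | inj₁ P.refl rewrite ≡ᵇ-refl x | remove-absent x L (T-not⇒¬T y∉L) = P.refl
  ... | y∉L , dL | inj₂ x∈L with y ≡ᵇ x in e
  ...   | true = ⊥-elim (T-not⇒¬T y∉L (P.subst (λ z → T (z ∈ᵇ L)) (P.sym (≡ᵇ≡true⇒≡ y x e)) x∈L))
  ...   | false rewrite count-remove f x L dL x∈L with f y | f x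
  ...     | true | true = P.refl
  ...     | true | false = P.refl
  ...     | false | true = P.refl
  ...     | false | false = P.refl

  length-remove : ∀ x L → T (distinctᵇ L) → T (x ∈ᵇ L) → suc (length (remove x L)) ≡ length L
  length-remove x L d x∈ = P.trans (P.cong suc (P.sym (count-true (remove x L))))
                                   (P.trans (P.sym (count-remove (λ _ → true) x L d x∈)) (count-true L))
    where
    count-true : ∀ L → countᵇ (λ _ → true) L ≡ length L
    count-true [] = P.refl
    count-true (_ ∷ L) = P.cong suc (count-true L)

  count-sameEntries : ∀ (f : ℕ → Bool) w S → T (distinctᵇ w) → T (distinctᵇ S) →
                      (∀ y → T (y ∈ᵇ w) → T (y ∈ᵇ S)) → length w ≡ length S → countᵇ f w ≡ countᵇ f S
  count-sameEntries f [] [] dw dS w⊆S len = P.refl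
  count-sameEntries f (y ∷ w) S dw dS w⊆S len with to (T-∧ {not (y ∈ᵇ w)}) dw
  ... | y∉w , dw′ = P.trans (cong-if (f y) ih) (P.sym (count-remove f y S dS y∈S))
    where
    y∈S = w⊆S y (∈ᵇ-here y w)
    w⊆S′ : ∀ z → T (z ∈ᵇ w) → T (z ∈ᵇ remove y S)
    w⊆S′ z t = ∈ᵇ-remove y z S (w⊆S z (∈ᵇ-there z y w t)) (λ { P.refl → T-not⇒¬T y∉w t })
    ih = count-sameEntries f w (remove y S) dw′ (filter-distinct _ S dS) w⊆S′
           (NP.suc-injective (P.trans len (P.sym (length-remove y S dS y∈S))))
    cong-if : ∀ b {k k′} → k ≡ k′ → (if b then suc k else k) ≡ (if b then suc k′ else k′)
    cong-if b P.refl = P.refl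

  count-remove-unselected : ∀ (f : ℕ → Bool) x L → f x ≡ false → countᵇ f (remove x L) ≡ countᵇ f L
  count-remove-unselected f x [] fx = P.refl
  count-remove-unselected f x (y ∷ L) fx with y ≡ᵇ x in e
  ... | true with P.refl ← ≡ᵇ≡true⇒≡ y x e rewrite fx = count-remove-unselected f x L fx
  ... | false with f y
  ...   | true = P.cong suc (count-remove-unselected f x L fx)
  ...   | false = count-remove-unselected f x L fx

  count-remove-≤ : ∀ x L → countᵇ (x ≤ᵇ_) (remove x L) ≡ countᵇ (x <ᵇ_) L
  count-remove-≤ x [] = P.refl
  count-remove-≤ x (y ∷ L) with y ≡ᵇ x in e
  ... | true with P.refl ← ≡ᵇ≡true⇒≡ y x e rewrite ≮⇒<ᵇ≡false (NP.<-irrefl {x} P.refl) = count-remove-≤ x L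
  ... | false rewrite ≤ᵇ≡<ᵇ (≡ᵇ≡false⇒≢ y x e ∘ P.sym) with x <ᵇ y
  ...   | true = P.cong suc (count-remove-≤ x L)
  ...   | false = count-remove-≤ x L

  count-none : ∀ (f : ℕ → Bool) L → (∀ y → T (y ∈ᵇ L) → f y ≡ false) → countᵇ f L ≡ 0
  count-none f [] h = P.refl
  count-none f (x ∷ L) h rewrite h x (∈ᵇ-here x L) = count-none f L (λ y t → h y (∈ᵇ-there y x L t))

  count-every : ∀ (f : ℕ → Bool) L → (∀ y → T (y ∈ᵇ L) → f y ≡ true) → countᵇ f L ≡ length L
  count-every f [] h = P.refl
  count-every f (x ∷ L) h rewrite h x (∈ᵇ-here x L) = P.cong suc (count-every f L (λ y t → h y (∈ᵇ-there y x L t)))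

  available-without : ∀ m p x → available m (without p x) ≡ remove x (available m p)
  available-without m p x = go (range 0 m)
    where
    go : ∀ L → filterᵇ (without p x) L ≡ remove x (filterᵇ p L)
    go [] = P.refl
    go (y ∷ L) with p y
    ... | false = go L
    ... | true with y ≡ᵇ x
    ...   | true = go L
    ...   | false = P.cong (y ∷_) (go L)

  length-available-without : ∀ m p x {n} → T (x ∈ᵇ available m p) → length (available m p) ≡ suc n →
                             length (available m (without p x)) ≡ n
  length-available-without m p x x∈ len = NP.suc-injective (begin
    suc (length (available m (without p x))) ≡⟨ P.cong (suc ∘ length) (available-without m p x) ⟩
    suc (length (remove x (available m p)))  ≡⟨ length-remove x (available m p) (available-distinct m p) x∈ ⟩
    length (available m p)                   ≡⟨ len ⟩
    _                                        ∎)
    where open P.≡-Reasoning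

  all-without : ∀ p x w → all (without p x) w ≡ (all p w ∧ not (x ∈ᵇ w))
  all-without p x [] = P.refl
  all-without p x (y ∷ w) rewrite all-without p x w | ≡ᵇ-sym y x with p y | x ≡ᵇ y
  ... | false | _ = P.refl
  ... | true | true = P.sym (∧-zeroʳ (all p w))
  ... | true | false = P.refl

  all-∈ᵇ : ∀ p w y → T (all p w) → T (y ∈ᵇ w) → T (p y)
  all-∈ᵇ p (x ∷ w) y a y∈ with to (T-∧ {p x}) a | ∈ᵇ-∷⁻ y x w y∈
  ... | px , _ | inj₁ P.refl = px
  ... | _ , aw | inj₂ y∈w = all-∈ᵇ p w y aw y∈w

  valid-spec : ∀ p c b w → valid p c b w ≡ (distinctᵇ w ∧ (all p w ∧ avoidsFrom c b w))
  valid-spec p c b [] = P.refl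
  valid-spec p c b (x ∷ w)
    rewrite valid-spec (without p x) (nextFloor c b x) (raise b x) w | all-without p x w
    with p x | c ≤ᵇ x | x ∈ᵇ w
  ... | false | _ | _ = P.sym (∧-zeroʳ _)
  ... | true | false | _ rewrite ∧-zeroʳ (all p w) = P.sym (∧-zeroʳ _)
  ... | true | true | true rewrite ∧-zeroʳ (all p w) = ∧-zeroʳ _
  ... | true | true | false rewrite ∧-identityʳ (all p w) = P.refl

  all-true : ∀ (w : List ℕ) → all (λ _ → true) w ≡ true
  all-true [] = P.refl
  all-true (_ ∷ w) = all-true w

  valid-initial : ∀ w → valid (λ _ → true) 0 0 w ≡ (distinctᵇ w ∧ not (has321 w))
  valid-initial w = begin
    valid (λ _ → true) 0 0 w
      ≡⟨ valid-spec (λ _ → true) 0 0 w ⟩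
    distinctᵇ w ∧ (all (λ _ → true) w ∧ avoidsFrom 0 0 w)
      ≡⟨ P.cong (λ a → distinctᵇ w ∧ (a ∧ avoidsFrom 0 0 w)) (all-true w) ⟩
    distinctᵇ w ∧ avoidsFrom 0 0 w
      ≡⟨ avoidance (distinctᵇ w) P.refl ⟩
    distinctᵇ w ∧ not (has321 w) ∎
    where
    open P.≡-Reasoning
    avoidance : ∀ d → distinctᵇ w ≡ d → (d ∧ avoidsFrom 0 0 w) ≡ (d ∧ not (has321 w))
    avoidance false _ = P.refl
    avoidance true e = avoidsFrom-initial w (from T-≡ e)

  below : ℕ → List ℕ → ℕ
  below b S = countᵇ (_<ᵇ b) S

  atLeast : ℕ → List ℕ → ℕ
  atLeast b S = countᵇ (b ≤ᵇ_) S

  above : ℕ → List ℕ → ℕ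
  above x S = countᵇ (x <ᵇ_) S

  below-head : ∀ a A → Increasing (a ∷ A) → below a (a ∷ A) ≡ 0
  below-head a A (a<A , _) rewrite ≮⇒<ᵇ≡false (NP.<-irrefl {a} P.refl) =
    count-none _ A (λ y y∈ → ≮⇒<ᵇ≡false (NP.<⇒≯ (a<A y y∈)))

  above-head : ∀ a A → Increasing (a ∷ A) → above a (a ∷ A) ≡ length A
  above-head a A (a<A , _) rewrite ≮⇒<ᵇ≡false (NP.<-irrefl {a} P.refl) =
    count-every _ A (λ y y∈ → <⇒<ᵇ≡true (a<A y y∈))

  below-tail : ∀ a A x → Increasing (a ∷ A) → T (x ∈ᵇ A) → below x (a ∷ A) ≡ suc (below x A)
  below-tail a A x (a<A , _) x∈ rewrite <⇒<ᵇ≡true (a<A x x∈) = P.refl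

  above-tail : ∀ a A x → Increasing (a ∷ A) → T (x ∈ᵇ A) → above x (a ∷ A) ≡ above x A
  above-tail a A x (a<A , _) x∈ rewrite ≮⇒<ᵇ≡false (NP.<⇒≯ (a<A x x∈)) = P.refl

  below-none : ∀ b S → (∀ y → T (y ∈ᵇ S) → b N.≤ y) → below b S ≡ 0
  below-none b S b≤S = count-none _ S (λ y y∈ → ≮⇒<ᵇ≡false (NP.≤⇒≯ (b≤S y y∈)))

  atLeast-all : ∀ b S → (∀ y → T (y ∈ᵇ S) → b N.≤ y) → atLeast b S ≡ length S
  atLeast-all b S b≤S = count-every _ S (λ y y∈ → ≤⇒≤ᵇ≡true (b≤S y y∈))

  ≤least : ∀ b a A → Increasing (a ∷ A) → b N.≤ a → ∀ y → T (y ∈ᵇ (a ∷ A)) → b N.≤ y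
  ≤least b a A (a<A , _) b≤a y y∈ with ∈ᵇ-∷⁻ y a A y∈
  ... | inj₁ P.refl = b≤a
  ... | inj₂ y∈A = NP.<⇒≤ (NP.≤-<-trans b≤a (a<A y y∈A))

-- §5  Finite sums in a commutative semiring

module Sums {c ℓ : Level} (R : CommutativeSemiring c ℓ) where
  open CommutativeSemiring R hiding (zero)
  open import Relation.Binary.Reasoning.Setoid setoid

  Σ : ∀ {a} {A : Set a} → (A → Carrier) → List A → Carrier
  Σ f xs = sumR R (map f xs)

  when : Bool → Carrier → Carrier
  when true a = a
  when false a = 0#

  Σ-cong : ∀ {a} {A : Set a} {f g : A → Carrier} xs → (∀ x → x ∈ xs → f x ≈ g x) → Σ f xs ≈ Σ g xs
  Σ-cong [] e = refl
  Σ-cong (x ∷ xs) e = +-cong (e x (here P.refl)) (Σ-cong xs (λ y y∈ → e y (there y∈)))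

  Σ-zero : ∀ {a} {A : Set a} {f : A → Carrier} xs → (∀ x → x ∈ xs → f x ≈ 0#) → Σ f xs ≈ 0#
  Σ-zero [] e = refl
  Σ-zero (x ∷ xs) e = trans (+-cong (e x (here P.refl)) (Σ-zero xs (λ y y∈ → e y (there y∈)))) (+-identityˡ 0#)

  Σ-++ : ∀ {a} {A : Set a} (f : A → Carrier) xs ys → Σ f (xs ++ ys) ≈ Σ f xs + Σ f ys
  Σ-++ f [] ys = sym (+-identityˡ _)
  Σ-++ f (x ∷ xs) ys = trans (+-cong refl (Σ-++ f xs ys)) (sym (+-assoc _ _ _))

  Σ-map : ∀ {a b} {A : Set a} {B : Set b} (f : B → Carrier) (g : A → B) xs → Σ f (map g xs) ≡ Σ (f ∘ g) xs
  Σ-map f g [] = P.refl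
  Σ-map f g (x ∷ xs) = P.cong (f (g x) +_) (Σ-map f g xs)

  Σ-concatMap : ∀ {a b} {A : Set a} {B : Set b} (f : B → Carrier) (g : A → List B) xs →
                Σ f (concatMap g xs) ≈ Σ (Σ f ∘ g) xs
  Σ-concatMap f g [] = refl
  Σ-concatMap f g (x ∷ xs) = trans (Σ-++ f (g x) (concatMap g xs)) (+-cong refl (Σ-concatMap f g xs))

  Σ-+ : ∀ {a} {A : Set a} (f g : A → Carrier) xs → Σ (λ x → f x + g x) xs ≈ Σ f xs + Σ g xs
  Σ-+ f g [] = sym (+-identityˡ 0#)
  Σ-+ f g (x ∷ xs) = trans (+-cong refl (Σ-+ f g xs)) (+-comm-middle (f x) (g x) (Σ f xs) (Σ g xs))
    where
    +-comm-middle : ∀ a b c d → (a + b) + (c + d) ≈ (a + c) + (b + d)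
    +-comm-middle a b c d = begin
      (a + b) + (c + d) ≈⟨ +-assoc a b (c + d) ⟩
      a + (b + (c + d)) ≈⟨ +-cong refl (sym (+-assoc b c d)) ⟩
      a + ((b + c) + d) ≈⟨ +-cong refl (+-cong (+-comm b c) refl) ⟩
      a + ((c + b) + d) ≈⟨ +-cong refl (+-assoc c b d) ⟩
      a + (c + (b + d)) ≈⟨ sym (+-assoc a c (b + d)) ⟩
      (a + c) + (b + d) ∎

  Σ-*ˡ : ∀ {a} {A : Set a} (k : Carrier) (f : A → Carrier) xs → k * Σ f xs ≈ Σ (λ x → k * f x) xs
  Σ-*ˡ k f [] = zeroʳ k
  Σ-*ˡ k f (x ∷ xs) = trans (distribˡ k _ _) (+-cong refl (Σ-*ˡ k f xs))

  Σ-swap : ∀ {a b} {A : Set a} {B : Set b} (f : A → B → Carrier) xs ys →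
           Σ (λ x → Σ (f x) ys) xs ≈ Σ (λ y → Σ (λ x → f x y) xs) ys
  Σ-swap f [] ys = sym (Σ-zero ys (λ _ _ → refl))
  Σ-swap f (x ∷ xs) ys = trans (+-cong refl (Σ-swap f xs ys)) (sym (Σ-+ (f x) (λ y → Σ (λ x → f x y) xs) ys))

  Σ-filter : ∀ {a p} {A : Set a} {Pr : A → Set p} (f : A → Carrier) (P? : ∀ x → Dec (Pr x)) xs →
             Σ f (filter P? xs) ≈ Σ (λ x → when (does (P? x)) (f x)) xs
  Σ-filter f P? [] = refl
  Σ-filter f P? (x ∷ xs) with does (P? x)
  ... | true = +-cong refl (Σ-filter f P? xs)
  ... | false = trans (Σ-filter f P? xs) (sym (+-identityˡ _))

  when-cong : ∀ b {x y} → x ≈ y → when b x ≈ when b y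
  when-cong true e = e
  when-cong false e = refl

  when-0 : ∀ b → when b 0# ≈ 0#
  when-0 true = refl
  when-0 false = refl

  when-∧ : ∀ a v K Q W → when (a ∧ v) (K * (Q * W)) ≈ when a (K * (Q * when v W))
  when-∧ true true K Q W = refl
  when-∧ true false K Q W = sym (trans (*-cong refl (zeroʳ Q)) (zeroʳ K))
  when-∧ false v K Q W = refl

  Σ-when : ∀ b K Q {a} {A : Set a} (G : A → Carrier) ws →
           Σ (λ w → when b (K * (Q * G w))) ws ≈ when b (K * (Q * Σ G ws))
  Σ-when false K Q G ws = Σ-zero ws (λ _ _ → refl)
  Σ-when true K Q G ws = sym (trans (*-cong refl (Σ-*ˡ Q G ws)) (Σ-*ˡ K (λ w → Q * G w) ws))

  pow-+ : ∀ x m n → pow R x (m N.+ n) ≈ pow R x m * pow R x n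
  pow-+ x zero n = sym (*-identityˡ _)
  pow-+ x (suc m) n = trans (*-cong refl (pow-+ x m n)) (sym (*-assoc _ _ _))

-- §6  The completion polynomials and their functional equation

module Polynomials {c ℓ : Level} (R : CommutativeSemiring c ℓ) (q : CommutativeSemiring.Carrier R) where
  open CommutativeSemiring R hiding (zero)
  open import Relation.Binary.Reasoning.Setoid setoid
  open import Algebra.Solver.Ring.NaturalCoefficients.Default R

  -- Φ t k e weighs the completions of a 321-avoiding prefix with k unused
  -- values below the maximum bound and e above it (§7).  Either the smallest
  -- value below the bound comes next, or a new maximum; Ψ t h u collects
  -- the second kind when h values lie below the bound and u + 1 above it:
  --   Ψ t h u = Σ_{i ≤ u} t q^(h+i) Φ t (h+i) (u-i).
  mutual
    Φ : Carrier → ℕ → ℕ → Carrier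
    Φ t h zero = 1#
    Φ t zero (suc u) = Ψ t zero u
    Φ t (suc h) (suc u) = Φ t h (suc u) + Ψ t (suc h) u

    Ψ : Carrier → ℕ → ℕ → Carrier
    Ψ t h zero = t * pow R q h * 1#
    Ψ t h (suc u) = t * pow R q h * Φ t h (suc u) + Ψ t (suc h) u

  -- Cauchy product: (f ⋆ g) u = Σ_{a+b=u} f a * g b.
  _⋆_ : (ℕ → Carrier) → (ℕ → Carrier) → ℕ → Carrier
  (f ⋆ g) zero = f 0 * g 0
  (f ⋆ g) (suc u) = f 0 * g (suc u) + ((f ∘ suc) ⋆ g) u

  ⋆-+ : ∀ f f′ g u → ((λ a → f a + f′ a) ⋆ g) u ≈ (f ⋆ g) u + (f′ ⋆ g) u
  ⋆-+ f f′ g zero = distribʳ _ _ _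
  ⋆-+ f f′ g (suc u) = begin
    (f 0 + f′ 0) * g (suc u) + ((λ a → f (suc a) + f′ (suc a)) ⋆ g) u
      ≈⟨ +-cong (distribʳ _ _ _) (⋆-+ (f ∘ suc) (f′ ∘ suc) g u) ⟩
    (f 0 * g (suc u) + f′ 0 * g (suc u)) + (((f ∘ suc) ⋆ g) u + ((f′ ∘ suc) ⋆ g) u)
      ≈⟨ solve 4 (λ a b c d → (a :+ b) :+ (c :+ d) := (a :+ c) :+ (b :+ d)) refl _ _ _ _ ⟩
    (f 0 * g (suc u) + ((f ∘ suc) ⋆ g) u) + (f′ 0 * g (suc u) + ((f′ ∘ suc) ⋆ g) u) ∎

  ⋆-*ˡ : ∀ k f g u → ((λ a → k * f a) ⋆ g) u ≈ k * (f ⋆ g) u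
  ⋆-*ˡ k f g zero = *-assoc _ _ _
  ⋆-*ˡ k f g (suc u) = trans (+-cong (*-assoc _ _ _) (⋆-*ˡ k (f ∘ suc) g u)) (sym (distribˡ _ _ _))

  -- One more value below the bound is absorbed by replacing t with q t.
  shift-weight : ∀ t h → t * pow R q (suc h) ≈ (q * t) * pow R q h
  shift-weight t h = solve 3 (λ t q Q → t :* (q :* Q) := (q :* t) :* Q) refl t q (pow R q h)

  mutual
    Φ-shift : ∀ t h u → Φ t (suc h) u ≈ (Φ (q * t) h ⋆ Φ t 0) u
    Φ-shift t h zero = sym (*-identityˡ 1#)
    Φ-shift t zero (suc u) = +-cong (sym (*-identityˡ _)) (Ψ-shift t 0 u)
    Φ-shift t (suc h) (suc u) = begin
      Φ t (suc h) (suc u) + Ψ t (suc (suc h)) u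
        ≈⟨ +-cong (Φ-shift t h (suc u)) (Ψ-shift t (suc h) u) ⟩
      (1# * Φ t 0 (suc u) + ((Φ (q * t) h ∘ suc) ⋆ Φ t 0) u) + (Ψ (q * t) (suc h) ⋆ Φ t 0) u
        ≈⟨ +-assoc _ _ _ ⟩
      1# * Φ t 0 (suc u) + (((Φ (q * t) h ∘ suc) ⋆ Φ t 0) u + (Ψ (q * t) (suc h) ⋆ Φ t 0) u)
        ≈⟨ +-cong refl (sym (⋆-+ (Φ (q * t) h ∘ suc) (Ψ (q * t) (suc h)) (Φ t 0) u)) ⟩
      (Φ (q * t) (suc h) ⋆ Φ t 0) (suc u) ∎

    Ψ-shift : ∀ t h u → Ψ t (suc h) u ≈ (Ψ (q * t) h ⋆ Φ t 0) u
    Ψ-shift t h zero = trans (*-cong (shift-weight t h) refl) (sym (*-identityʳ _))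
    Ψ-shift t h (suc u) = begin
      t * pow R q (suc h) * Φ t (suc h) (suc u) + Ψ t (suc (suc h)) u
        ≈⟨ +-cong (*-cong (shift-weight t h) (Φ-shift t h (suc u))) (Ψ-shift t (suc h) u) ⟩
      K * (1# * G + C₁) + C₂
        ≈⟨ solve 5 (λ K G C₁ C₂ one → K :* (one :* G :+ C₁) :+ C₂ := (K :* one) :* G :+ (K :* C₁ :+ C₂))
                   refl K G C₁ C₂ 1# ⟩
      (K * 1#) * G + (K * C₁ + C₂)
        ≈⟨ +-cong refl (+-cong (sym (⋆-*ˡ K (Φ (q * t) h ∘ suc) (Φ t 0) u)) refl) ⟩
      (K * 1#) * G + (((λ a → K * Φ (q * t) h (suc a)) ⋆ Φ t 0) u + C₂)
        ≈⟨ +-cong refl (sym (⋆-+ (λ a → K * Φ (q * t) h (suc a)) (Ψ (q * t) (suc h)) (Φ t 0) u)) ⟩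
      (Ψ (q * t) h ⋆ Φ t 0) (suc u) ∎
      where
      K = q * t * pow R q h
      G = Φ t 0 (suc u)
      C₁ = ((Φ (q * t) h ∘ suc) ⋆ Φ t 0) u
      C₂ = (Ψ (q * t) (suc h) ⋆ Φ t 0) u


  -- Ψ₊ t h e sums over all choices of a new maximum among e values above the bound.
  Ψ₊ : Carrier → ℕ → ℕ → Carrier
  Ψ₊ t h zero = 0#
  Ψ₊ t h (suc u) = Ψ t h u

  Φ-step : ∀ t h e → Φ t h e + Ψ₊ t (suc h) e ≈ Φ t (suc h) e
  Φ-step t h zero = +-identityʳ _
  Φ-step t h (suc e) = refl

  Ψ-step : ∀ t h e → t * (pow R q h * Φ t h e) + Ψ₊ t (suc h) e ≈ Ψ t h e
  Ψ-step t h zero = trans (+-identityʳ _) (sym (*-assoc _ _ _))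
  Ψ-step t h (suc e) = +-cong (sym (*-assoc _ _ _)) refl

-- §7  State sums

module StateSums {c ℓ : Level} (R : CommutativeSemiring c ℓ) (q : CommutativeSemiring.Carrier R) where
  open CommutativeSemiring R hiding (zero)
  open import Relation.Binary.Reasoning.Setoid setoid
  open import Algebra.Solver.Ring.NaturalCoefficients.Default R
  open Sums R
  open Polynomials R q
  open Translation
  open AvailableSets

  words : ℕ → ℕ → List (List ℕ)
  words zero m = [] ∷ []
  words (suc n) m = concatMap (λ w → map (_∷ w) (range 0 m)) (words n m)

  Σ-words : ∀ n m (f : List ℕ → Carrier) →
            Σ f (words (suc n) m) ≈ Σ (λ w → Σ (λ x → f (x ∷ w)) (range 0 m)) (words n m)
  Σ-words n m f = trans (Σ-concatMap f (λ w → map (_∷ w) (range 0 m)) (words n m))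
                        (Σ-cong (words n m) (λ w _ → reflexive (Σ-map f (_∷ w) (range 0 m))))

  Σ-words-cong : ∀ n m {f g : List ℕ → Carrier} →
    (∀ w → length w ≡ n → (∀ y → T (y ∈ᵇ w) → y N.< m) → f w ≈ g w) → Σ f (words n m) ≈ Σ g (words n m)
  Σ-words-cong zero m e = +-cong (e [] P.refl (λ _ ())) refl
  Σ-words-cong (suc n) m {f} {g} e = begin
    Σ f (words (suc n) m)                                    ≈⟨ Σ-words n m f ⟩
    Σ (λ w → Σ (λ x → f (x ∷ w)) (range 0 m)) (words n m)    ≈⟨ Σ-words-cong n m extend ⟩
    Σ (λ w → Σ (λ x → g (x ∷ w)) (range 0 m)) (words n m)    ≈⟨ sym (Σ-words n m g) ⟩
    Σ g (words (suc n) m)                                    ∎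
    where
    extend : ∀ w → length w ≡ n → (∀ y → T (y ∈ᵇ w) → y N.< m) →
             Σ (λ x → f (x ∷ w)) (range 0 m) ≈ Σ (λ x → g (x ∷ w)) (range 0 m)
    extend w len w<m = Σ-cong (range 0 m) λ x x∈ → e (x ∷ w) (P.cong suc len) λ y y∈ →
      [ (λ { P.refl → proj₂ (∈ᵇ-range⁻ x 0 m (∈⇒∈ᵇ x∈)) }) , w<m y ] (∈ᵇ-∷⁻ y x w y∈)

  range-tabulate : ∀ a m (f : Fin m → ℕ) → (∀ i → f i ≡ a N.+ toℕ i) → tabulate f ≡ range a m
  range-tabulate a zero f e = P.refl
  range-tabulate a (suc m) f e = P.cong₂ _∷_ (P.trans (e F.zero) (NP.+-identityʳ a))
    (range-tabulate (suc a) m (f ∘ F.suc) (λ i → P.trans (e (F.suc i)) (NP.+-suc a (toℕ i))))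

  Σ-allFuns : ∀ n m (h : List ℕ → Carrier) → Σ (h ∘ word) (allFuns n m) ≈ Σ h (words n m)
  Σ-allFuns zero m h = refl
  Σ-allFuns (suc n) m h = begin
    Σ (h ∘ word) (allFuns (suc n) m)
      ≈⟨ Σ-concatMap (h ∘ word) (λ f → map (λ x → consF x f) (allFin m)) (allFuns n m) ⟩
    Σ (λ f → Σ (h ∘ word) (map (λ x → consF x f) (allFin m))) (allFuns n m)
      ≈⟨ Σ-cong (allFuns n m) (λ f _ → reflexive (firstLetters f)) ⟩
    Σ (λ f → Σ (λ x → h (x ∷ word f)) (range 0 m)) (allFuns n m)
      ≈⟨ Σ-allFuns n m (λ w → Σ (λ x → h (x ∷ w)) (range 0 m)) ⟩
    Σ (λ w → Σ (λ x → h (x ∷ w)) (range 0 m)) (words n m)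
      ≈⟨ sym (Σ-words n m h) ⟩
    Σ h (words (suc n) m) ∎
    where
    firstLetters : ∀ f → Σ (h ∘ word) (map (λ x → consF x f) (allFin m)) ≡ Σ (λ x → h (x ∷ word f)) (range 0 m)
    firstLetters f = P.trans (Σ-map (h ∘ word) (λ x → consF x f) (allFin m))
      (P.trans (P.sym (Σ-map (λ x → h (x ∷ word f)) toℕ (allFin m)))
               (P.cong (Σ (λ x → h (x ∷ word f)))
                       (P.trans (LP.map-tabulate id toℕ) (range-tabulate 0 m toℕ (λ _ → P.refl)))))
      where import Data.List.Properties as LP

  weight : Carrier → ℕ → List ℕ → Carrier
  weight t b w = pow R q (invW w) * pow R t (lrmW b w)

  stateSum : Carrier → ℕ → ℕ → (ℕ → Bool) → ℕ → ℕ → Carrier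
  stateSum t m n p c b = Σ (λ w → when (valid p c b w) (weight t b w)) (words n m)

  I≈stateSum : ∀ t n → I R q t n ≈ stateSum t n n (λ _ → true) 0 0
  I≈stateSum t n = begin
    I R q t n
      ≈⟨ Σ-filter _ av321? (allFuns n n) ⟩
    Σ (λ σ → when (does (av321? σ)) (pow R q (inv σ) * pow R t (lrm σ))) (allFuns n n)
      ≈⟨ Σ-cong (allFuns n n) (λ σ _ → reflexive (P.cong₂ when
            (P.trans (av321?-word σ) (P.sym (valid-initial (word σ))))
            (P.cong₂ (λ a b → pow R q a * pow R t b) (inv≡invW σ) (lrm≡lrmW σ)))) ⟩
    Σ ((λ w → when (valid (λ _ → true) 0 0 w) (weight t 0 w)) ∘ word) (allFuns n n)
      ≈⟨ Σ-allFuns n n _ ⟩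
    stateSum t n n (λ _ → true) 0 0 ∎

  isMax : ℕ → ℕ → ℕ
  isMax b x = if b ≤ᵇ x then 1 else 0

  lrmW-∷ : ∀ b x w → lrmW b (x ∷ w) ≡ isMax b x N.+ lrmW (raise b x) w
  lrmW-∷ b x w with b ≤ᵇ x
  ... | true = P.refl
  ... | false = P.refl

  weight-∷ : ∀ t b x w →
             weight t b (x ∷ w) ≈ pow R t (isMax b x) * (pow R q (countᵇ (_<ᵇ x) w) * weight t (raise b x) w)
  weight-∷ t b x w = begin
    pow R q (countᵇ (_<ᵇ x) w N.+ invW w) * pow R t (lrmW b (x ∷ w))
      ≡⟨ P.cong (λ k → pow R q (countᵇ (_<ᵇ x) w N.+ invW w) * pow R t k) (lrmW-∷ b x w) ⟩
    pow R q (countᵇ (_<ᵇ x) w N.+ invW w) * pow R t (isMax b x N.+ lrmW (raise b x) w)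
      ≈⟨ *-cong (pow-+ q (countᵇ (_<ᵇ x) w) (invW w)) (pow-+ t (isMax b x) (lrmW (raise b x) w)) ⟩
    (A * B) * (C * D)
      ≈⟨ solve 4 (λ A B C D → (A :* B) :* (C :* D) := C :* (A :* (B :* D))) refl A B C D ⟩
    C * (A * (B * D)) ∎
    where
    A = pow R q (countᵇ (_<ᵇ x) w)
    B = pow R q (invW w)
    C = pow R t (isMax b x)
    D = pow R t (lrmW (raise b x) w)

  -- A valid word of the right length uses up exactly the available values,
  -- so its counts are those of the available set.
  count-valid : ∀ (f : ℕ → Bool) m n p c b w → length w ≡ n → (∀ y → T (y ∈ᵇ w) → y N.< m) →
                length (available m p) ≡ n → T (valid p c b w) → countᵇ f w ≡ countᵇ f (available m p)
  count-valid f m n p c b w len w<m lenS v with to T-∧ (P.subst T (valid-spec p c b w) v)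
  ... | distinct , rest = count-sameEntries f w (available m p) distinct (available-distinct m p)
        (λ y y∈ → ∈ᵇ-available⁺ m p y (w<m y y∈) (all-∈ᵇ p w y (proj₁ (to (T-∧ {all p w}) rest)) y∈))
        (P.trans len (P.sym lenS))

  firstLetterTerm : Carrier → ℕ → ℕ → (ℕ → Bool) → ℕ → ℕ → ℕ → Carrier
  firstLetterTerm t m n p c b x =
    pow R t (isMax b x) * (pow R q (countᵇ (_<ᵇ x) (available m (without p x)))
                           * stateSum t m n (without p x) (nextFloor c b x) (raise b x))

  stateSum-∷ : ∀ t m n p c b → length (available m p) ≡ suc n →
               stateSum t m (suc n) p c b ≈ Σ (λ x → when (c ≤ᵇ x) (firstLetterTerm t m n p c b x)) (available m p)
  stateSum-∷ t m n p c b lenS = begin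
    stateSum t m (suc n) p c b
      ≈⟨ Σ-words n m F ⟩
    Σ (λ w → Σ (λ x → F (x ∷ w)) (range 0 m)) (words n m)
      ≈⟨ Σ-swap (λ w x → F (x ∷ w)) (words n m) (range 0 m) ⟩
    Σ (λ x → Σ (λ w → F (x ∷ w)) (words n m)) (range 0 m)
      ≈⟨ Σ-cong (range 0 m) (λ x x∈ → startingWith x (proj₂ (∈ᵇ-range⁻ x 0 m (∈⇒∈ᵇ x∈)))) ⟩
    Σ (λ x → when (p x) (when (c ≤ᵇ x) (firstLetterTerm t m n p c b x))) (range 0 m)
      ≈⟨ sym (Σ-filter _ (T? ∘ p) (range 0 m)) ⟩
    Σ (λ x → when (c ≤ᵇ x) (firstLetterTerm t m n p c b x)) (available m p) ∎
    where
    F : List ℕ → Carrier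
    F w = when (valid p c b w) (weight t b w)

    startingWith : ∀ x → x N.< m →
                   Σ (λ w → F (x ∷ w)) (words n m) ≈ when (p x) (when (c ≤ᵇ x) (firstLetterTerm t m n p c b x))
    startingWith x x<m with p x in px
    ... | false = Σ-zero (words n m) (λ _ _ → refl)
    ... | true = begin
      Σ (λ w → when ((c ≤ᵇ x) ∧ V w) (weight t b (x ∷ w))) (words n m)
        ≈⟨ Σ-words-cong n m (λ w len w<m → trans (when-cong ((c ≤ᵇ x) ∧ V w) (weight-∷ t b x w))
                                                 (trans (when-∧ (c ≤ᵇ x) (V w) K _ _)
                                                        (when-cong (c ≤ᵇ x) (*-cong refl (sameCount w len w<m))))) ⟩
      Σ (λ w → when (c ≤ᵇ x) (K * (Q * G w))) (words n m)
        ≈⟨ Σ-when (c ≤ᵇ x) K Q G (words n m) ⟩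
      when (c ≤ᵇ x) (firstLetterTerm t m n p c b x) ∎
      where
      V = valid (without p x) (nextFloor c b x) (raise b x)
      K = pow R t (isMax b x)
      Q = pow R q (countᵇ (_<ᵇ x) (available m (without p x)))
      G : List ℕ → Carrier
      G w = when (V w) (weight t (raise b x) w)
      x∈S : T (x ∈ᵇ available m p)
      x∈S = ∈ᵇ-available⁺ m p x x<m (from T-≡ px)
      sameCount : ∀ w → length w ≡ n → (∀ y → T (y ∈ᵇ w) → y N.< m) →
                  pow R q (countᵇ (_<ᵇ x) w) * G w ≈ Q * G w
      sameCount w len w<m with V w in v
      ... | false = trans (zeroʳ _) (sym (zeroʳ _))
      ... | true = reflexive (P.cong (λ k → pow R q k * weight t (raise b x) w)
                     (count-valid (_<ᵇ x) m n (without p x) _ _ w len w<m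
                        (length-available-without m p x x∈S lenS) (from T-≡ v)))

  term-max : ∀ t m n p c b x → b N.≤ x → firstLetterTerm t m n p c b x ≡
    pow R t 1 * (pow R q (below x (available m (without p x))) * stateSum t m n (without p x) c x)
  term-max t m n p c b x b≤x rewrite ≤⇒≤ᵇ≡true b≤x = P.refl

  term-low : ∀ t m n p c b x → x N.< b → firstLetterTerm t m n p c b x ≡
    pow R t 0 * (pow R q (below x (available m (without p x))) * stateSum t m n (without p x) (suc x) b)
  term-low t m n p c b x x<b rewrite >⇒≤ᵇ≡false x<b = P.refl

  raise-≥ : ∀ b x → b N.≤ raise b x
  raise-≥ b x = proj₁ (raise-≤⁻ b x NP.≤-refl)

  nextFloor-≥ : ∀ c b x → c N.≤ x → c N.≤ nextFloor c b x
  nextFloor-≥ c b x c≤x with b ≤ᵇ x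
  ... | true = NP.≤-refl
  ... | false = NP.m≤n⇒m≤1+n c≤x

  -- An available value below both the floor and the bound can never be
  -- written, so there is no valid word of full length.
  stateSum-stuck : ∀ t m n p c b v → length (available m p) ≡ n → T (v ∈ᵇ available m p) →
                   v N.< b → v N.< c → stateSum t m n p c b ≈ 0#
  stateSum-stuck t m zero p c b v len v∈ _ _ with available m p | len | v∈
  ... | [] | _ | ()
  stateSum-stuck t m (suc n) p c b v len v∈ v<b v<c =
    trans (stateSum-∷ t m n p c b len) (Σ-zero (available m p) (λ x x∈ → vanishes x (∈⇒∈ᵇ x∈)))
    where
    vanishes : ∀ x → T (x ∈ᵇ available m p) → when (c ≤ᵇ x) (firstLetterTerm t m n p c b x) ≈ 0#
    vanishes x x∈ with c ≤ᵇ x in e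
    ... | false = refl
    ... | true = trans (*-cong refl (trans (*-cong refl stuck) (zeroʳ _))) (zeroʳ _)
      where
      c≤x = ≤ᵇ≡true⇒≤ e
      v∈′ : T (v ∈ᵇ available m (without p x))
      v∈′ = P.subst (λ S → T (v ∈ᵇ S)) (P.sym (available-without m p x))
                    (∈ᵇ-remove x v (available m p) v∈ (λ { P.refl → NP.<⇒≱ v<c c≤x }))
      stuck = stateSum-stuck t m n (without p x) (nextFloor c b x) (raise b x) v
                (length-available-without m p x x∈ len) v∈′
                (NP.<-≤-trans v<b (raise-≥ b x)) (NP.<-≤-trans v<c (nextFloor-≥ c b x c≤x))

  -- The terms of the new maxima x ≥ b of an increasing list A, where D more
  -- values lie below all of A, add up to Ψ₊.
  maxWeight : Carrier → ℕ → ℕ → Carrier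
  maxWeight t k e = t * (pow R q k * Φ t k e)

  newMaxTerm : Carrier → ℕ → ℕ → List ℕ → ℕ → Carrier
  newMaxTerm t b D A x = when (b ≤ᵇ x) (maxWeight t (D N.+ below x A) (above x A))

  newMaxima-sum : ∀ t b D A → Increasing A → Σ (newMaxTerm t b D A) A ≈ Ψ₊ t (D N.+ below b A) (atLeast b A)
  newMaxima-sum t b D [] _ = refl
  newMaxima-sum t b D (a ∷ A) inc@(_ , incA) = begin
    newMaxTerm t b D (a ∷ A) a + Σ (newMaxTerm t b D (a ∷ A)) A
      ≈⟨ +-cong (reflexive headTerm) (trans (Σ-cong A tailTerm) (newMaxima-sum t b (suc D) A incA)) ⟩
    when (b ≤ᵇ a) (maxWeight t (D N.+ 0) (length A)) + Ψ₊ t (suc D N.+ below b A) (atLeast b A)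
      ≈⟨ combine (b NP.≤? a) ⟩
    Ψ₊ t (D N.+ below b (a ∷ A)) (atLeast b (a ∷ A)) ∎
    where
    headTerm : newMaxTerm t b D (a ∷ A) a ≡ when (b ≤ᵇ a) (maxWeight t (D N.+ 0) (length A))
    headTerm rewrite below-head a A inc | above-head a A inc = P.refl
    tailTerm : ∀ x → x ∈ A → newMaxTerm t b D (a ∷ A) x ≈ newMaxTerm t b (suc D) A x
    tailTerm x x∈ rewrite below-tail a A x inc (∈⇒∈ᵇ x∈) | above-tail a A x inc (∈⇒∈ᵇ x∈)
                        | NP.+-suc D (below x A) = refl
    combine : Dec (b N.≤ a) →
      when (b ≤ᵇ a) (maxWeight t (D N.+ 0) (length A)) + Ψ₊ t (suc D N.+ below b A) (atLeast b A)
        ≈ Ψ₊ t (D N.+ below b (a ∷ A)) (atLeast b (a ∷ A))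
    combine (yes b≤a) = begin
      when (b ≤ᵇ a) X + Ψ₊ t (suc D N.+ below b A) (atLeast b A)
        ≡⟨ P.cong₂ (λ z k → when z X + Ψ₊ t (suc D N.+ k) (atLeast b A))
                   (≤⇒≤ᵇ≡true b≤a) (below-none b A ≤A) ⟩
      X + Ψ₊ t (suc D N.+ 0) (atLeast b A)
        ≡⟨ P.cong (λ e → X + Ψ₊ t (suc D N.+ 0) e) (atLeast-all b A ≤A) ⟩
      X + Ψ₊ t (suc (D N.+ 0)) (length A)
        ≈⟨ Ψ-step t (D N.+ 0) (length A) ⟩
      Ψ₊ t (D N.+ 0) (suc (length A))
        ≡⟨ P.sym (P.cong₂ (λ k e → Ψ₊ t (D N.+ k) e) (below-none b (a ∷ A) ≤S) (atLeast-all b (a ∷ A) ≤S)) ⟩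
      Ψ₊ t (D N.+ below b (a ∷ A)) (atLeast b (a ∷ A)) ∎
      where
      X = maxWeight t (D N.+ 0) (length A)
      ≤S = ≤least b a A inc b≤a
      ≤A : ∀ y → T (y ∈ᵇ A) → b N.≤ y
      ≤A y y∈ = ≤S y (∈ᵇ-there y a A y∈)
    combine (no b≰a) rewrite >⇒≤ᵇ≡false (NP.≰⇒> b≰a) | <⇒<ᵇ≡true (NP.≰⇒> b≰a) | NP.+-suc D (below b A) =
      +-identityˡ _

  -- The sum over first letters from an increasing set S = u₀ ∷ U of available
  -- values.  If the least value u₀ is at least the bound, every letter is a
  -- new maximum.
  firstLetter-sum-max : ∀ t b c u₀ U (term : ℕ → Carrier) → Increasing (u₀ ∷ U) → c N.≤ b → b N.≤ u₀ →
    (∀ x → T (x ∈ᵇ (u₀ ∷ U)) → b N.≤ x → term x ≈ maxWeight t (below x (u₀ ∷ U)) (above x (u₀ ∷ U))) →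
    Σ (λ x → when (c ≤ᵇ x) (term x)) (u₀ ∷ U) ≈ Φ t (below b (u₀ ∷ U)) (atLeast b (u₀ ∷ U))
  firstLetter-sum-max t b c u₀ U term inc c≤b b≤u₀ newMax = begin
    Σ (λ x → when (c ≤ᵇ x) (term x)) S  ≈⟨ Σ-cong S (λ x x∈ → asNewMax x (∈⇒∈ᵇ x∈)) ⟩
    Σ (newMaxTerm t b 0 S) S             ≈⟨ newMaxima-sum t b 0 S inc ⟩
    Ψ₊ t (below b S) (atLeast b S)       ≡⟨ P.cong₂ (Ψ₊ t) (below-none b S ≤S) (atLeast-all b S ≤S) ⟩
    Φ t 0 (suc (length U))               ≡⟨ P.sym (P.cong₂ (Φ t) (below-none b S ≤S) (atLeast-all b S ≤S)) ⟩
    Φ t (below b S) (atLeast b S)        ∎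
    where
    S = u₀ ∷ U
    ≤S = ≤least b u₀ U inc b≤u₀
    asNewMax : ∀ x → T (x ∈ᵇ S) → when (c ≤ᵇ x) (term x) ≈ newMaxTerm t b 0 S x
    asNewMax x x∈ rewrite ≤⇒≤ᵇ≡true (NP.≤-trans c≤b (≤S x x∈)) | ≤⇒≤ᵇ≡true (≤S x x∈) =
      newMax x x∈ (≤S x x∈)

  -- If u₀ lies below the bound, it must come first (any other letter below
  -- the bound leaves u₀ stuck), or else a new maximum comes first.
  firstLetter-sum-low : ∀ t b c u₀ U (term : ℕ → Carrier) → Increasing (u₀ ∷ U) → c N.≤ u₀ → u₀ N.< b →
    term u₀ ≈ Φ t (below b U) (atLeast b U) →
    (∀ x → T (x ∈ᵇ U) → b N.≤ x → term x ≈ maxWeight t (below x (u₀ ∷ U)) (above x (u₀ ∷ U))) →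
    (∀ x → T (x ∈ᵇ U) → x N.< b → term x ≈ 0#) →
    Σ (λ x → when (c ≤ᵇ x) (term x)) (u₀ ∷ U) ≈ Φ t (below b (u₀ ∷ U)) (atLeast b (u₀ ∷ U))
  firstLetter-sum-low t b c u₀ U term inc@(u₀<U , incU) c≤u₀ u₀<b least newMax blocked = begin
    when (c ≤ᵇ u₀) (term u₀) + Σ (λ x → when (c ≤ᵇ x) (term x)) U
      ≈⟨ +-cong first (Σ-cong U (λ x x∈ → later x (∈⇒∈ᵇ x∈))) ⟩
    Φ t (below b U) (atLeast b U) + Σ (newMaxTerm t b 1 U) U
      ≈⟨ +-cong refl (newMaxima-sum t b 1 U incU) ⟩
    Φ t (below b U) (atLeast b U) + Ψ₊ t (suc (below b U)) (atLeast b U)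
      ≈⟨ Φ-step t (below b U) (atLeast b U) ⟩
    Φ t (suc (below b U)) (atLeast b U)
      ≡⟨ P.sym (P.cong₂ (Φ t) belowS atLeastS) ⟩
    Φ t (below b (u₀ ∷ U)) (atLeast b (u₀ ∷ U)) ∎
    where
    belowS : below b (u₀ ∷ U) ≡ suc (below b U)
    belowS rewrite <⇒<ᵇ≡true u₀<b = P.refl
    atLeastS : atLeast b (u₀ ∷ U) ≡ atLeast b U
    atLeastS rewrite >⇒≤ᵇ≡false u₀<b = P.refl
    first : when (c ≤ᵇ u₀) (term u₀) ≈ Φ t (below b U) (atLeast b U)
    first rewrite ≤⇒≤ᵇ≡true c≤u₀ = least
    later : ∀ x → T (x ∈ᵇ U) → when (c ≤ᵇ x) (term x) ≈ newMaxTerm t b 1 U x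
    later x x∈ with b NP.≤? x
    ... | yes b≤x rewrite ≤⇒≤ᵇ≡true (NP.<⇒≤ (NP.≤-<-trans c≤u₀ (u₀<U x x∈))) | ≤⇒≤ᵇ≡true b≤x =
      trans (newMax x x∈ b≤x)
            (reflexive (P.cong₂ (maxWeight t) (below-tail u₀ U x inc x∈) (above-tail u₀ U x inc x∈)))
    ... | no b≰x rewrite >⇒≤ᵇ≡false (NP.≰⇒> b≰x) =
      trans (when-cong (c ≤ᵇ x) (blocked x x∈ (NP.≰⇒> b≰x))) (when-0 (c ≤ᵇ x))

  -- The
  -- floor condition says that every available value below the bound may
  -- still be written.
  ClosedForm : Carrier → ℕ → ℕ → Set ℓ
  ClosedForm t m n = ∀ p c b → length (available m p) ≡ n → c N.≤ b →
    (∀ v → T (v ∈ᵇ available m p) → v N.< b → c N.≤ v) →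
    stateSum t m n p c b ≈ Φ t (below b (available m p)) (atLeast b (available m p))

  -- Writing a new maximum x first leaves x as the bound and the floor unchanged.
  newMax-term : ∀ t m n → ClosedForm t m n → ∀ p c b → length (available m p) ≡ suc n → c N.≤ b →
    (∀ v → T (v ∈ᵇ available m p) → v N.< b → c N.≤ v) →
    ∀ x → T (x ∈ᵇ available m p) → b N.≤ x →
    firstLetterTerm t m n p c b x ≈ maxWeight t (below x (available m p)) (above x (available m p))
  newMax-term t m n closed p c b len c≤b floorOK x x∈ b≤x = begin
    firstLetterTerm t m n p c b x
      ≡⟨ term-max t m n p c b x b≤x ⟩
    pow R t 1 * (pow R q (below x Sₓ) * stateSum t m n (without p x) c x)
      ≈⟨ *-cong (*-identityʳ t) (*-cong refl (closed (without p x) c x lenₓ (NP.≤-trans c≤b b≤x) floorₓ)) ⟩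
    maxWeight t (below x Sₓ) (atLeast x Sₓ)
      ≡⟨ P.cong₂ (maxWeight t) belowₓ atLeastₓ ⟩
    maxWeight t (below x S) (above x S) ∎
    where
    S = available m p
    Sₓ = available m (without p x)
    lenₓ = length-available-without m p x x∈ len
    floorₓ : ∀ v → T (v ∈ᵇ Sₓ) → v N.< x → c N.≤ v
    floorₓ v v∈ v<x with v NP.<? b
    ... | yes v<b = floorOK v v∈S v<b
      where v∈S = proj₁ (∈ᵇ-filter⁻ _ v S (P.subst (λ L → T (v ∈ᵇ L)) (available-without m p x) v∈))
    ... | no v≮b = NP.≤-trans c≤b (NP.≮⇒≥ v≮b)
    belowₓ : below x Sₓ ≡ below x S
    belowₓ = P.trans (P.cong (below x) (available-without m p x))
                     (count-remove-unselected _ x S (≮⇒<ᵇ≡false (NP.<-irrefl {x} P.refl)))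
    atLeastₓ : atLeast x Sₓ ≡ above x S
    atLeastₓ = P.trans (P.cong (atLeast x) (available-without m p x)) (count-remove-≤ x S)

  -- Writing the least available value u₀ < b first raises the floor past u₀.
  least-term : ∀ t m n → ClosedForm t m n → ∀ p b u₀ U → available m p ≡ u₀ ∷ U →
    length (u₀ ∷ U) ≡ suc n → u₀ N.< b → ∀ c → firstLetterTerm t m n p c b u₀ ≈ Φ t (below b U) (atLeast b U)
  least-term t m n closed p b u₀ U S≡ len u₀<b c = begin
    firstLetterTerm t m n p c b u₀
      ≡⟨ term-low t m n p c b u₀ u₀<b ⟩
    pow R t 0 * (pow R q (below u₀ S₀) * stateSum t m n (without p u₀) (suc u₀) b)
      ≡⟨ P.cong (λ k → pow R t 0 * (pow R q k * stateSum t m n (without p u₀) (suc u₀) b))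
                (P.trans (P.cong (below u₀) S₀≡U) belowU) ⟩
    1# * (1# * stateSum t m n (without p u₀) (suc u₀) b)
      ≈⟨ trans (*-identityˡ _) (*-identityˡ _) ⟩
    stateSum t m n (without p u₀) (suc u₀) b
      ≈⟨ closed (without p u₀) (suc u₀) b len₀ u₀<b floor₀ ⟩
    Φ t (below b S₀) (atLeast b S₀)
      ≡⟨ P.cong (λ L → Φ t (below b L) (atLeast b L)) S₀≡U ⟩
    Φ t (below b U) (atLeast b U) ∎
    where
    S₀ = available m (without p u₀)
    inc : Increasing (u₀ ∷ U)
    inc = P.subst Increasing S≡ (available-increasing m p)
    S₀≡U : S₀ ≡ U
    S₀≡U = P.trans (available-without m p u₀)
             (P.trans (P.cong (remove u₀) S≡)
               (P.trans (remove-head u₀ U)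
                        (remove-absent u₀ U (λ u₀∈U → NP.<-irrefl P.refl (proj₁ inc u₀ u₀∈U)))))
    belowU : below u₀ U ≡ 0
    belowU = count-none _ U (λ y y∈ → ≮⇒<ᵇ≡false (NP.<⇒≯ (proj₁ inc y y∈)))
    len₀ : length S₀ ≡ n
    len₀ = P.trans (P.cong length S₀≡U) (NP.suc-injective len)
    floor₀ : ∀ v → T (v ∈ᵇ S₀) → v N.< b → suc u₀ N.≤ v
    floor₀ v v∈ _ = proj₁ inc v (P.subst (λ L → T (v ∈ᵇ L)) S₀≡U v∈)

  -- Writing first a value x < b other than the least one u₀ < x leaves u₀ stuck.
  blocked-term : ∀ t m n p c b u₀ x → length (available m p) ≡ suc n → T (u₀ ∈ᵇ available m p) →
    T (x ∈ᵇ available m p) → u₀ N.< x → x N.< b → firstLetterTerm t m n p c b x ≈ 0#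
  blocked-term t m n p c b u₀ x len u₀∈ x∈ u₀<x x<b =
    trans (reflexive (term-low t m n p c b x x<b)) (trans (*-cong refl (trans (*-cong refl stuck) (zeroʳ _))) (zeroʳ _))
    where
    u₀∈ₓ : T (u₀ ∈ᵇ available m (without p x))
    u₀∈ₓ = P.subst (λ L → T (u₀ ∈ᵇ L)) (P.sym (available-without m p x))
                   (∈ᵇ-remove x u₀ (available m p) u₀∈ (λ { P.refl → NP.<-irrefl P.refl u₀<x }))
    stuck = stateSum-stuck t m n (without p x) (suc x) b u₀ (length-available-without m p x x∈ len) u₀∈ₓ
              (NP.<-trans u₀<x x<b) (NP.m<n⇒m<1+n u₀<x)

  stateSum-closed : ∀ t m n → ClosedForm t m n
  stateSum-closed t m zero p c b len c≤b floorOK with available m p | len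
  ... | [] | _ = trans (+-identityʳ _) (*-identityˡ _)
  stateSum-closed t m (suc n) p c b len c≤b floorOK =
    trans (stateSum-∷ t m n p c b len) (sumFirstLetters (available m p) P.refl)
    where
    closed = stateSum-closed t m n
    Term = firstLetterTerm t m n p c b

    sumFirstLetters : ∀ S → available m p ≡ S →
                      Σ (λ x → when (c ≤ᵇ x) (Term x)) S ≈ Φ t (below b S) (atLeast b S)
    sumFirstLetters [] S≡ = ⊥-elim (NP.0≢1+n (P.trans (P.cong length (P.sym S≡)) len))
    sumFirstLetters (u₀ ∷ U) S≡ = byLeast (b NP.≤? u₀)
      where
      inc : Increasing (u₀ ∷ U)
      inc = P.subst Increasing S≡ (available-increasing m p)
      inS : ∀ x → T (x ∈ᵇ (u₀ ∷ U)) → T (x ∈ᵇ available m p)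
      inS x x∈ = P.subst (λ L → T (x ∈ᵇ L)) (P.sym S≡) x∈
      newMax : ∀ x → T (x ∈ᵇ (u₀ ∷ U)) → b N.≤ x →
               Term x ≈ maxWeight t (below x (u₀ ∷ U)) (above x (u₀ ∷ U))
      newMax x x∈ b≤x = P.subst (λ L → Term x ≈ maxWeight t (below x L) (above x L)) S≡
                                (newMax-term t m n closed p c b len c≤b floorOK x (inS x x∈) b≤x)
      byLeast : Dec (b N.≤ u₀) →
                Σ (λ x → when (c ≤ᵇ x) (Term x)) (u₀ ∷ U) ≈ Φ t (below b (u₀ ∷ U)) (atLeast b (u₀ ∷ U))
      byLeast (yes b≤u₀) = firstLetter-sum-max t b c u₀ U Term inc c≤b b≤u₀ newMax
      byLeast (no b≰u₀) = firstLetter-sum-low t b c u₀ U Term inc (floorOK u₀ (inS u₀ u₀∈) u₀<b) u₀<b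
        (least-term t m n closed p b u₀ U S≡ (P.trans (P.cong length (P.sym S≡)) len) u₀<b c)
        (λ x x∈ → newMax x (∈ᵇ-there x u₀ U x∈))
        (λ x x∈ → blocked-term t m n p c b u₀ x len (inS u₀ u₀∈) (inS x (∈ᵇ-there x u₀ U x∈))
                                (proj₁ inc x x∈))
        where
        u₀<b = NP.≰⇒> b≰u₀
        u₀∈ = ∈ᵇ-here u₀ U

  I≈Φ : ∀ t n → I R q t n ≈ Φ t 0 n
  I≈Φ t n = begin
    I R q t n                                       ≈⟨ I≈stateSum t n ⟩
    stateSum t n n everything 0 0                         ≈⟨ stateSum-closed t n n everything 0 0 len z≤n (λ _ _ ()) ⟩
    Φ t (below 0 (available n everything)) (atLeast 0 (available n everything))
                                                    ≡⟨ P.cong₂ (Φ t) (below-none 0 S (λ _ _ → z≤n))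
                                                                     (P.trans (atLeast-all 0 S (λ _ _ → z≤n)) len) ⟩
    Φ t 0 n                                         ∎
    where
    everything : ℕ → Bool
    everything _ = true
    S = available n everything
    len : length (available n everything) ≡ n
    len = P.trans (P.cong length (filter-all (range 0 n))) (length-range 0 n)
      where
      filter-all : ∀ L → filterᵇ everything L ≡ L
      filter-all [] = P.refl
      filter-all (x ∷ L) = P.cong (x ∷_) (filter-all L)
      length-range : ∀ a n → length (range a n) ≡ n
      length-range a zero = P.refl
      length-range a (suc n) = P.cong suc (length-range (suc a) n)

-- §8  The recurrence

module Recurrence {c ℓ : Level} (R : CommutativeSemiring c ℓ) (q : CommutativeSemiring.Carrier R) where
  open CommutativeSemiring R hiding (zero)
  open import Relation.Binary.Reasoning.Setoid setoid
  open import Data.List.Membership.Propositional.Properties using (∈-upTo⁻)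
  import Data.List.Properties as LP
  open Sums R
  open Polynomials R q
  open StateSums R q using (I≈Φ)

  ⋆-as-Σ : ∀ f g u → (f ⋆ g) u ≈ Σ (λ k → g k * f (u ∸ k)) (upTo (suc u))
  ⋆-as-Σ f g zero = trans (*-comm _ _) (sym (+-identityʳ _))
  ⋆-as-Σ f g (suc u) = begin
    f 0 * g (suc u) + ((f ∘ suc) ⋆ g) u
      ≈⟨ +-cong refl (⋆-as-Σ (f ∘ suc) g u) ⟩
    f 0 * g (suc u) + Σ (λ k → g k * f (suc (u ∸ k))) (upTo (suc u))
      ≈⟨ +-comm _ _ ⟩
    Σ (λ k → g k * f (suc (u ∸ k))) (upTo (suc u)) + f 0 * g (suc u)
      ≈⟨ +-cong (Σ-cong (upTo (suc u)) (λ k k∈ → reflexive (P.cong (λ j → g k * f j) (suc-∸ k∈))))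
                (trans (*-comm _ _) (trans (*-cong refl (reflexive (P.cong f (P.sym (NP.n∸n≡0 u)))))
                                           (sym (+-identityʳ _)))) ⟩
    Σ h (upTo (suc u)) + Σ h (suc u ∷ [])
      ≈⟨ sym (Σ-++ h (upTo (suc u)) (suc u ∷ [])) ⟩
    Σ h (upTo (suc u) ++ suc u ∷ [])
      ≡⟨ P.cong (Σ h) (LP.upTo-∷ʳ (suc u)) ⟩
    Σ h (upTo (suc (suc u))) ∎
    where
    h : ℕ → Carrier
    h k = g k * f (suc u ∸ k)
    suc-∸ : ∀ {k} → k ∈ upTo (suc u) → suc (u ∸ k) ≡ suc u ∸ k
    suc-∸ k∈ = P.sym (NP.+-∸-assoc 1 (NP.≤-pred (∈-upTo⁻ k∈)))

  -- I_{n+2} = Φ t 0 (n+2) = Ψ t 0 (n+1): the first letter is either the least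
  -- value (weight t, leaving I_{n+1}) or a larger one, which contributes
  -- Ψ t 1 n; the functional equation turns the latter into the Cauchy product.
  recurrence : ∀ t n → I R q t (suc n) ≈ (t * I R q t n + Σ (λ k → I R q t k * I R q (q * t) (n ∸ k)) (upTo n))
  recurrence t zero = begin
    I R q t 1             ≈⟨ I≈Φ t 1 ⟩
    t * 1# * 1#           ≈⟨ *-identityʳ _ ⟩
    t * 1#                ≈⟨ sym (trans (+-identityʳ _) (*-cong refl (I≈Φ t 0))) ⟩
    t * I R q t 0 + 0#    ∎
  recurrence t (suc n) = begin
    I R q t (suc (suc n))
      ≈⟨ I≈Φ t (suc (suc n)) ⟩
    t * 1# * Φ t 0 (suc n) + Ψ t 1 n
      ≈⟨ +-cong (*-cong (*-identityʳ t) (sym (I≈Φ t (suc n)))) (Ψ-shift t 0 n) ⟩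
    t * I R q t (suc n) + (Ψ (q * t) 0 ⋆ Φ t 0) n
      ≈⟨ +-cong refl (⋆-as-Σ (Ψ (q * t) 0) (Φ t 0) n) ⟩
    t * I R q t (suc n) + Σ (λ k → Φ t 0 k * Ψ (q * t) 0 (n ∸ k)) (upTo (suc n))
      ≈⟨ +-cong refl (Σ-cong (upTo (suc n)) (λ k k∈ → *-cong (sym (I≈Φ t k)) (shifted k k∈))) ⟩
    t * I R q t (suc n) + Σ (λ k → I R q t k * I R q (q * t) (suc n ∸ k)) (upTo (suc n)) ∎
    where
    -- Ψ (q t) 0 j = Φ (q t) 0 (j + 1) = I_{j+1}(q, q t).
    shifted : ∀ k → k ∈ upTo (suc n) → Ψ (q * t) 0 (n ∸ k) ≈ I R q (q * t) (suc n ∸ k)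
    shifted k k∈ = trans (reflexive (P.cong (Φ (q * t) 0) (P.sym (NP.+-∸-assoc 1 (NP.≤-pred (∈-upTo⁻ k∈))))))
                         (sym (I≈Φ (q * t) (suc n ∸ k)))

corollary8p8 : ∀ {c ℓ : Level} (R : CommutativeSemiring c ℓ) →
    let open CommutativeSemiring R in
    ∀ (q t : Carrier) (n : ℕ) →
    I R q t (suc n) ≈ (t * I R q t n + sumR R (map (λ k → I R q t k * I R q (q * t) (n ∸ k)) (upTo n)))
corollary8p8 R q t n = Recurrence.recurrence R q t n
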